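{- Let $C(t,s,x,y)=\sum_G t^{\#DH(G)}s^{\#UH(G)}x^{\#H(G)}y^{\#U(G)}$, the sum over all bargraphs $G$. Then $$txC^2-(1-x-y+xy-txy-sxy)C+sxy=0.$$ In particular, the generating function for bargraphs with no occurrence of $DH$ is $\frac{xy}{1-x-y}$.
   Context: A bargraph is a lattice path with steps $U=(0,1)$, $H=(1,0)$, $D=(0,-1)$, identified with its word over $\{U,H,D\}$, that starts at the origin, ends on the $x$-axis, stays strictly above the $x$-axis except at its endpoints, and contains no two consecutive steps $UD$ or $DU$ (the empty path is not a bargraph). $\#H(G)$, $\#U(G)$ denote the numbers of $H$ and $U$ steps; $\#DH(G)$ and $\#UH(G)$ denote the numbers of occurrences of the consecutive factors $DH$ and $UH$ in $G$. -}

module Defs where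

open import Data.Bool using (Bool; true; false; _∧_; not; if_then_else_)
open import Data.Nat as ℕ using (ℕ; zero; suc; _≡ᵇ_)
open import Data.Integer as ℤ using (ℤ; +_; 0ℤ; 1ℤ)
open import Data.List using (List; []; _∷_; map; concatMap; upTo; foldr)
open import Data.Vec using (Vec; []; _∷_; replicate)
open import Data.Vec.Properties using (≡-dec)
open import Data.Product using (_×_; _,_)
open import Relation.Binary.PropositionalEquality using (_≡_)
open import Relation.Nullary.Decidable using (⌊_⌋; does)

data Step : Set where
  U H D : Step

δ : Step → ℤ
δ U = + 1
δ H = 0ℤ
δ D = ℤ.-[1+ 0 ]

stays : ℤ → List Step → Bool
stays y []      = ⌊ y ℤ.≟ 0ℤ ⌋
stays y (s ∷ w) = ⌊ 0ℤ ℤ.<? y ⌋ ∧ stays (y ℤ.+ δ s) w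

noUDDU : List Step → Bool
noUDDU (U ∷ D ∷ w) = false
noUDDU (D ∷ U ∷ w) = false
noUDDU (s ∷ w)     = noUDDU w
noUDDU []          = true

-- path starts at origin, nonempty (the single-step path H lies on the axis,
-- so at least two steps), ends on the x-axis, all intermediate vertices
-- strictly above the x-axis, and no UD / DU.
isBargraph : List Step → Bool
isBargraph []          = false
isBargraph (s ∷ [])    = false
isBargraph (s ∷ s' ∷ w) = stays (δ s) (s' ∷ w) ∧ noUDDU (s ∷ s' ∷ w)

isH isU : Step → Bool
isH H = true
isH _ = false
isU U = true
isU _ = false

count : (Step → Bool) → List Step → ℕ
count p []      = 0
count p (s ∷ w) = (if p s then 1 else 0) ℕ.+ count p w

#H #U : List Step → ℕ
#H = count isH
#U = count isU

_=ˢ_ : Step → Step → Bool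
U =ˢ U = true
H =ˢ H = true
D =ˢ D = true
_ =ˢ _ = false

#factor : Step → Step → List Step → ℕ
#factor a b []           = 0
#factor a b (s ∷ [])     = 0
#factor a b (s ∷ s' ∷ w) =
  (if (s =ˢ a) ∧ (s' =ˢ b) then 1 else 0) ℕ.+ #factor a b (s' ∷ w)

#DH #UH : List Step → ℕ
#DH = #factor D H
#UH = #factor U H

#sat : ∀ {A : Set} → (A → Bool) → List A → ℕ
#sat p []      = 0
#sat p (a ∷ l) = (if p a then 1 else 0) ℕ.+ #sat p l

words : ℕ → List (List Step)
words zero    = [] ∷ []
words (suc n) = concatMap (λ w → (U ∷ w) ∷ (H ∷ w) ∷ (D ∷ w) ∷ []) (words n)

-- Formal power series in n commuting variables with integer coefficients,
-- given by their coefficient function on exponent vectors.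

Series : ℕ → Set
Series n = Vec ℕ n → ℤ

splits : ∀ {n} → Vec ℕ n → List (Vec ℕ n × Vec ℕ n)
splits []      = ([] , []) ∷ []
splits (m ∷ v) =
  concatMap (λ i → map (λ { (p , q) → (i ∷ p , (m ℕ.∸ i) ∷ q) }) (splits v))
            (upTo (suc m))

infixl 6 _⊕_ _⊖_
infixl 7 _⊗_

_⊕_ : ∀ {n} → Series n → Series n → Series n
(f ⊕ g) v = f v ℤ.+ g v

_⊖_ : ∀ {n} → Series n → Series n → Series n
(f ⊖ g) v = f v ℤ.- g v

_⊗_ : ∀ {n} → Series n → Series n → Series n
(f ⊗ g) v = foldr ℤ._+_ 0ℤ (map (λ { (p , q) → f p ℤ.* g q }) (splits v))

mono : ∀ {n} → Vec ℕ n → Series n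
mono e v = if does (≡-dec ℕ._≟_ v e) then 1ℤ else 0ℤ

𝟘 𝟙 : ∀ {n} → Series n
𝟘 v = 0ℤ
𝟙 = mono (replicate _ 0)

-- The generating function C(t,s,x,y); variables ordered (t , s , x , y).  Such a G has #D = #U = u, hence length
-- h + 2u, so it suffices to enumerate words of that length.

matches : ℕ → ℕ → ℕ → ℕ → List Step → Bool
matches a b h u G =
  isBargraph G ∧ (#DH G ≡ᵇ a) ∧ (#UH G ≡ᵇ b) ∧ (#H G ≡ᵇ h) ∧ (#U G ≡ᵇ u)

C : Series 4
C (a ∷ b ∷ h ∷ u ∷ []) = + #sat (matches a b h u) (words (h ℕ.+ 2 ℕ.* u))

tᶜ sᶜ xᶜ yᶜ : Series 4
tᶜ = mono (1 ∷ 0 ∷ 0 ∷ 0 ∷ [])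
sᶜ = mono (0 ∷ 1 ∷ 0 ∷ 0 ∷ [])
xᶜ = mono (0 ∷ 0 ∷ 1 ∷ 0 ∷ [])
yᶜ = mono (0 ∷ 0 ∷ 0 ∷ 1 ∷ [])

noDH : ℕ → ℕ → List Step → Bool
noDH h u G = isBargraph G ∧ (#DH G ≡ᵇ 0) ∧ (#H G ≡ᵇ h) ∧ (#U G ≡ᵇ u)

B : Series 2
B (h ∷ u ∷ []) = + #sat (noDH h u) (words (h ℕ.+ 2 ℕ.* u))

x² y² : Series 2
x² = mono (1 ∷ 0 ∷ [])
y² = mono (0 ∷ 1 ∷ [])

_≐_ : ∀ {n} → Series n → Series n → Set
f ≐ g = ∀ v → f v ≡ g v

module Submission where

-- Cut a bargraph G after its last H-step at height 1. If there is none, G = U B D for a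
-- bargraph B, contributing yC; if that H is followed by the final D, G lies in the class L
-- of bargraphs ending in HD; otherwise G = x B D where x D ∈ L and B is a bargraph, and the
-- statistics of x D and B add up. Hence C = yC + L + LC. Deleting the H of the final HD of
-- G ∈ L leaves either UD (G = UHD, weight sxy) or a bargraph G′, and the deleted H was
-- preceded by H (G′ ∈ L, weight x) or by D (G′ ∉ L, weight tx). Hence
-- L = sxy + xL + tx(C − L), and eliminating L gives the quadratic equation. At t⁰ the
-- quadratic term vanishes, and summing over the exponent of s gives (1 − x − y)B = xy.
-- All identities are checked coefficientwise: multiplying by a monomial shifts coefficients,
-- and the coefficient of weight (a, b, h, u) counts words of length h + 2u.

open import Defs
open import Data.Product using (_×_; _,_)

module WordSums where

  open import Data.Nat using (ℕ; zero; suc; _+_; _*_; _≡ᵇ_)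
  open import Data.Nat.Properties
  open import Algebra.Properties.CommutativeSemigroup +-commutativeSemigroup using (interchange)
  open import Data.List using (List; []; _∷_; _++_; length; concatMap)
  open import Data.Bool using (Bool; true; false; if_then_else_; T)
  open import Data.Empty using (⊥-elim)
  open import Relation.Nullary using (¬_; yes; no)
  open import Relation.Binary.PropositionalEquality
  open import Data.Nat.Solver using (module +-*-Solver)
  open +-*-Solver

  sumMap : {A : Set} → List A → (A → ℕ) → ℕ
  sumMap [] f = 0
  sumMap (x ∷ l) f = f x + sumMap l f

  sumMap-cong : ∀ {A : Set} (l : List A) {f g : A → ℕ} → (∀ x → f x ≡ g x) → sumMap l f ≡ sumMap l g
  sumMap-cong [] e = refl
  sumMap-cong (x ∷ l) e = cong₂ _+_ (e x) (sumMap-cong l e)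

  sumMap-+ : ∀ {A : Set} (l : List A) (f g : A → ℕ) → sumMap l (λ x → f x + g x) ≡ sumMap l f + sumMap l g
  sumMap-+ [] f g = refl
  sumMap-+ (x ∷ l) f g rewrite sumMap-+ l f g =
    interchange (f x) (g x) (sumMap l f) (sumMap l g)

  sumMap-* : ∀ {A : Set} (l : List A) (c : ℕ) (f : A → ℕ) → sumMap l (λ x → c * f x) ≡ c * sumMap l f
  sumMap-* [] c f = sym (*-zeroʳ c)
  sumMap-* (x ∷ l) c f rewrite sumMap-* l c f = sym (*-distribˡ-+ c (f x) (sumMap l f))

  sumMap-zero : ∀ {A : Set} (l : List A) (f : A → ℕ) → (∀ x → f x ≡ 0) → sumMap l f ≡ 0
  sumMap-zero [] f e = refl
  sumMap-zero (x ∷ l) f e rewrite e x = sumMap-zero l f e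

  #sat≡sumMap : ∀ {A : Set} (p : A → Bool) (l : List A) → #sat p l ≡ sumMap l (λ x → if p x then 1 else 0)
  #sat≡sumMap p [] = refl
  #sat≡sumMap p (x ∷ l) = cong ((if p x then 1 else 0) +_) (#sat≡sumMap p l)

  sumWords : ℕ → (List Step → ℕ) → ℕ
  sumWords n f = sumMap (words n) f

  sumWords-suc : ∀ n (f : List Step → ℕ) → sumWords (suc n) f ≡ sumWords n (λ w → f (U ∷ w) + (f (H ∷ w) + f (D ∷ w)))
  sumWords-suc n f = aux (words n)
    where
    aux : ∀ l → sumMap (concatMap (λ w → (U ∷ w) ∷ (H ∷ w) ∷ (D ∷ w) ∷ []) l) f
              ≡ sumMap l (λ w → f (U ∷ w) + (f (H ∷ w) + f (D ∷ w)))
    aux [] = refl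
    aux (w ∷ l) rewrite aux l =
      solve 4 (λ a b c d → a :+ (b :+ (c :+ d)) := (a :+ (b :+ c)) :+ d) refl
        (f (U ∷ w)) (f (H ∷ w)) (f (D ∷ w)) (sumMap l (λ w → f (U ∷ w) + (f (H ∷ w) + f (D ∷ w))))

  sumWords-cong : ∀ n {f g : List Step → ℕ} → (∀ w → length w ≡ n → f w ≡ g w) → sumWords n f ≡ sumWords n g
  sumWords-cong zero e = cong (_+ 0) (e [] refl)
  sumWords-cong (suc n) {f} {g} e rewrite sumWords-suc n f | sumWords-suc n g =
    sumWords-cong n (λ w lw → cong₂ _+_ (e (U ∷ w) (cong suc lw))
                        (cong₂ _+_ (e (H ∷ w) (cong suc lw)) (e (D ∷ w) (cong suc lw))))

  sumWords-+ : ∀ n (f g : List Step → ℕ) → sumWords n (λ w → f w + g w) ≡ sumWords n f + sumWords n g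
  sumWords-+ n f g = sumMap-+ (words n) f g

  sumWords-* : ∀ n c (f : List Step → ℕ) → sumWords n (λ w → c * f w) ≡ c * sumWords n f
  sumWords-* n c f = sumMap-* (words n) c f

  sumWords-zero : ∀ n (f : List Step → ℕ) → (∀ w → length w ≡ n → f w ≡ 0) → sumWords n f ≡ 0
  sumWords-zero n f e = trans (sumWords-cong n e) (sumMap-zero (words n) (λ _ → 0) (λ _ → refl))

  sumWords-++ : ∀ k m (f : List Step → ℕ) → sumWords (k + m) f ≡ sumWords k (λ a → sumWords m (λ b → f (a ++ b)))
  sumWords-++ zero m f = sym (+-identityʳ _)
  sumWords-++ (suc k) m f =
    begin
      sumWords (suc (k + m)) f
    ≡⟨ sumWords-suc (k + m) f ⟩
      sumWords (k + m) (λ w → f (U ∷ w) + (f (H ∷ w) + f (D ∷ w)))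
    ≡⟨ sumWords-++ k m _ ⟩
      sumWords k (λ a → sumWords m (λ b → f (U ∷ a ++ b) + (f (H ∷ a ++ b) + f (D ∷ a ++ b))))
    ≡⟨ sumWords-cong k (λ a _ → trans (sumWords-+ m _ _) (cong (sumWords m (λ b → f (U ∷ a ++ b)) +_) (sumWords-+ m _ _))) ⟩
      sumWords k (λ a → sumWords m (λ b → f (U ∷ a ++ b)) + (sumWords m (λ b → f (H ∷ a ++ b)) + sumWords m (λ b → f (D ∷ a ++ b))))
    ≡⟨ sym (sumWords-suc k _) ⟩
      sumWords (suc k) (λ a → sumWords m (λ b → f (a ++ b)))
    ∎
    where open ≡-Reasoning

  sumWords-snoc : ∀ n (f : List Step → ℕ) →
    sumWords (suc n) f ≡ sumWords n (λ w → f (w ++ U ∷ []) + (f (w ++ H ∷ []) + f (w ++ D ∷ [])))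
  sumWords-snoc n f =
    begin
      sumWords (suc n) f
    ≡⟨ cong (λ k → sumWords k f) (+-comm 1 n) ⟩
      sumWords (n + 1) f
    ≡⟨ sumWords-++ n 1 f ⟩
      sumWords n (λ a → sumWords 1 (λ b → f (a ++ b)))
    ≡⟨ sumWords-cong n (λ a _ → cong (f (a ++ U ∷ []) +_) (cong (f (a ++ H ∷ []) +_) (+-identityʳ _))) ⟩
      sumWords n (λ w → f (w ++ U ∷ []) + (f (w ++ H ∷ []) + f (w ++ D ∷ [])))
    ∎
    where open ≡-Reasoning

  ≡ᵇ-true⇒≡ : ∀ m n → (m ≡ᵇ n) ≡ true → m ≡ n
  ≡ᵇ-true⇒≡ m n e = ≡ᵇ⇒≡ m n (subst T (sym e) _)

  ≡ᵇ-refl : ∀ a → (a ≡ᵇ a) ≡ true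
  ≡ᵇ-refl zero = refl
  ≡ᵇ-refl (suc a) = ≡ᵇ-refl a

  sumWords-support : ∀ m L (f : List Step → ℕ) → (∀ w → ¬ f w ≡ 0 → length w ≡ L) →
    sumWords m f ≡ (if m ≡ᵇ L then sumWords L f else 0)
  sumWords-support m L f h with m ≡ᵇ L in eq
  ... | true rewrite ≡ᵇ-true⇒≡ m L eq = refl
  ... | false = sumWords-zero m f λ w lw → aux w lw
    where
    aux : ∀ w → length w ≡ m → f w ≡ 0
    aux w lw with f w ≟ 0
    ... | yes p = p
    ... | no np = ⊥-elim (subst T eq (≡⇒≡ᵇ m L (trans (sym lw) (h w np))))

  sumCuts : (List Step → List Step → ℕ) → List Step → ℕ
  sumCuts F [] = F [] []
  sumCuts F (s ∷ G) = F [] (s ∷ G) + sumCuts (λ x y → F (s ∷ x) y) G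

  sumPairs : ℕ → (ℕ → ℕ → ℕ) → ℕ
  sumPairs zero g = g 0 0
  sumPairs (suc n) g = g 0 (suc n) + sumPairs n (λ k m → g (suc k) m)

  sumPairs-cong : ∀ n {g h : ℕ → ℕ → ℕ} → (∀ k m → k + m ≡ n → g k m ≡ h k m) → sumPairs n g ≡ sumPairs n h
  sumPairs-cong zero e = e 0 0 refl
  sumPairs-cong (suc n) e = cong₂ _+_ (e 0 (suc n) refl) (sumPairs-cong n (λ k m km → e (suc k) m (cong suc km)))

  sumPairs-+ : ∀ n (g h : ℕ → ℕ → ℕ) → sumPairs n (λ k m → g k m + h k m) ≡ sumPairs n g + sumPairs n h
  sumPairs-+ zero g h = refl
  sumPairs-+ (suc n) g h rewrite sumPairs-+ n (λ k m → g (suc k) m) (λ k m → h (suc k) m) =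
    interchange (g 0 (suc n)) (h 0 (suc n)) (sumPairs n (λ k m → g (suc k) m)) (sumPairs n (λ k m → h (suc k) m))

  sumWords-sumCuts : ∀ n (F : List Step → List Step → ℕ) →
    sumWords n (sumCuts F) ≡ sumPairs n (λ k m → sumWords k (λ x → sumWords m (λ y → F x y)))
  sumWords-sumCuts zero F = sym (+-identityʳ _)
  sumWords-sumCuts (suc n) F =
    begin
      sumWords (suc n) (sumCuts F)
    ≡⟨ sumWords-suc n (sumCuts F) ⟩
      sumWords n (λ w → (F [] (U ∷ w) + sumCuts FU w) + ((F [] (H ∷ w) + sumCuts FH w) + (F [] (D ∷ w) + sumCuts FD w)))
    ≡⟨ sumWords-cong n (λ w _ → solve 6 (λ a b c d e f →
                 (a :+ b) :+ ((c :+ d) :+ (e :+ f)) := (a :+ (c :+ e)) :+ (b :+ (d :+ f))) refl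
                 (F [] (U ∷ w)) (sumCuts FU w) (F [] (H ∷ w)) (sumCuts FH w) (F [] (D ∷ w)) (sumCuts FD w)) ⟩
      sumWords n (λ w → (F [] (U ∷ w) + (F [] (H ∷ w) + F [] (D ∷ w))) + (sumCuts FU w + (sumCuts FH w + sumCuts FD w)))
    ≡⟨ sumWords-+ n _ _ ⟩
      sumWords n (λ w → F [] (U ∷ w) + (F [] (H ∷ w) + F [] (D ∷ w)))
        + sumWords n (λ w → sumCuts FU w + (sumCuts FH w + sumCuts FD w))
    ≡⟨ cong₂ _+_ (sym (sumWords-suc n (F [])))
                 (trans (sumWords-+ n _ _) (cong (sumWords n (sumCuts FU) +_) (sumWords-+ n _ _))) ⟩
      sumWords (suc n) (F []) + (sumWords n (sumCuts FU) + (sumWords n (sumCuts FH) + sumWords n (sumCuts FD)))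
    ≡⟨ cong₂ _+_ (sym (+-identityʳ (sumWords (suc n) (F []))))
                 (cong₂ _+_ (sumWords-sumCuts n FU) (cong₂ _+_ (sumWords-sumCuts n FH) (sumWords-sumCuts n FD))) ⟩
      (sumWords (suc n) (F []) + 0) + (sumPairs n (g FU) + (sumPairs n (g FH) + sumPairs n (g FD)))
    ≡⟨ cong ((sumWords (suc n) (F []) + 0) +_)
            (sym (trans (sumPairs-+ n _ _) (cong (sumPairs n (g FU) +_) (sumPairs-+ n _ _)))) ⟩
      (sumWords (suc n) (F []) + 0) + sumPairs n (λ k m → g FU k m + (g FH k m + g FD k m))
    ≡⟨ cong ((sumWords (suc n) (F []) + 0) +_) (sumPairs-cong n (λ k m _ →
         sym (trans (sumWords-suc k _) (trans (sumWords-+ k _ _) (cong (g FU k m +_) (sumWords-+ k _ _)))))) ⟩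
      sumPairs (suc n) (λ k m → sumWords k (λ x → sumWords m (λ y → F x y)))
    ∎
    where
    open ≡-Reasoning
    FU FH FD : List Step → List Step → ℕ
    FU x y = F (U ∷ x) y
    FH x y = F (H ∷ x) y
    FD x y = F (D ∷ x) y
    g : (List Step → List Step → ℕ) → ℕ → ℕ → ℕ
    g G k m = sumWords k (λ x → sumWords m (λ y → G x y))

  sumCuts-cong : ∀ (w : List Step) {F G : List Step → List Step → ℕ} → (∀ x y → F x y ≡ G x y) → sumCuts F w ≡ sumCuts G w
  sumCuts-cong [] e = e [] []
  sumCuts-cong (s ∷ w) e = cong₂ _+_ (e [] (s ∷ w)) (sumCuts-cong w (λ x y → e (s ∷ x) y))

  sumCuts-zero : ∀ (w : List Step) (F : List Step → List Step → ℕ) → (∀ x y → x ++ y ≡ w → F x y ≡ 0) → sumCuts F w ≡ 0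
  sumCuts-zero [] F e = e [] [] refl
  sumCuts-zero (s ∷ w) F e rewrite e [] (s ∷ w) refl =
    sumCuts-zero w (λ x y → F (s ∷ x) y) (λ x y xy → e (s ∷ x) y (cong (s ∷_) xy))

  sumCuts-* : ∀ (F : List Step → List Step → ℕ) (c : List Step → ℕ) G →
    sumCuts F G * c G ≡ sumCuts (λ x y → F x y * c (x ++ y)) G
  sumCuts-* F c [] = refl
  sumCuts-* F c (s ∷ G) = trans (*-distribʳ-+ (c (s ∷ G)) (F [] (s ∷ G)) _)
    (cong (F [] (s ∷ G) * c (s ∷ G) +_) (sumCuts-* (λ x y → F (s ∷ x) y) (λ G' → c (s ∷ G')) G))

  sumMap-swap : ∀ {A B : Set} (l1 : List A) (l2 : List B) (g : A → B → ℕ) →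
    sumMap l1 (λ a → sumMap l2 (λ b → g a b)) ≡ sumMap l2 (λ b → sumMap l1 (λ a → g a b))
  sumMap-swap [] l2 g = sym (sumMap-zero l2 _ (λ _ → refl))
  sumMap-swap (a ∷ l1) l2 g = trans (cong (sumMap l2 (g a) +_) (sumMap-swap l1 l2 g)) (sym (sumMap-+ l2 _ _))

  sumPairs-sumMap : ∀ {A : Set} n (l : List A) (G : ℕ → ℕ → A → ℕ) →
    sumPairs n (λ k m → sumMap l (G k m)) ≡ sumMap l (λ a → sumPairs n (λ k m → G k m a))
  sumPairs-sumMap zero l G = refl
  sumPairs-sumMap (suc n) l G =
    trans (cong (sumMap l (G 0 (suc n)) +_) (sumPairs-sumMap n l (λ k m → G (suc k) m))) (sym (sumMap-+ l _ _))

  sumPairs-zero : ∀ n (g : ℕ → ℕ → ℕ) → (∀ k m → g k m ≡ 0) → sumPairs n g ≡ 0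
  sumPairs-zero zero g e = e 0 0
  sumPairs-zero (suc n) g e rewrite e 0 (suc n) = sumPairs-zero n _ (λ k m → e (suc k) m)

  sumPairs-indicator : ∀ n l l' (X Y : ℕ) → l + l' ≡ n →
    sumPairs n (λ k m → (if k ≡ᵇ l then X else 0) * (if m ≡ᵇ l' then Y else 0)) ≡ X * Y
  sumPairs-indicator zero zero zero X Y e = refl
  sumPairs-indicator zero zero (suc l') X Y ()
  sumPairs-indicator zero (suc l) l' X Y ()
  sumPairs-indicator (suc n) zero l' X Y e rewrite e | ≡ᵇ-refl n =
    trans (cong (X * Y +_) (sumPairs-zero n _ (λ k m → refl))) (+-identityʳ _)
  sumPairs-indicator (suc n) (suc l) l' X Y e = sumPairs-indicator n l l' X Y (suc-injective e)

module BargraphWalks where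

  open WordSums using (sumCuts; sumCuts-cong; sumCuts-zero; ≡ᵇ-true⇒≡)
  open import Data.Nat using (ℕ; zero; suc; _+_; _≡ᵇ_; pred)
  open import Data.Nat.Properties
  open import Data.Nat.Solver using (module +-*-Solver)
  open +-*-Solver using (solve; _:+_; _:=_; con)
  open import Data.Integer as ℤ using (+_)
  open import Data.List using (List; []; _∷_; _++_)
  open import Data.Vec using (Vec; []; _∷_)
  open import Data.Bool using (Bool; true; false; if_then_else_; _∧_; _∨_; not)
  open import Data.Bool.Properties using (∧-assoc; ∧-comm; ∧-zeroʳ; ∧-identityʳ; ∨-identityʳ; ∨-comm)
  open import Data.Empty using (⊥-elim; ⊥)
  open import Relation.Binary.PropositionalEquality

  ⟦_⟧ : Bool → ℕ
  ⟦ b ⟧ = if b then 1 else 0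

  compatible : Step → Step → Bool
  compatible U D = false
  compatible D U = false
  compatible U U = true
  compatible U H = true
  compatible H U = true
  compatible H H = true
  compatible H D = true
  compatible D H = true
  compatible D D = true

  nextHeight : ℕ → Step → ℕ
  nextHeight h U = suc h
  nextHeight h H = h
  nextHeight h D = pred h

  completes : ℕ → Step → List Step → Bool
  completes zero p [] = true
  completes (suc h) p [] = false
  completes zero p (s ∷ w) = false
  completes (suc h) p (s ∷ w) = compatible p s ∧ completes (nextHeight (suc h) s) s w

  isBargraph′ : List Step → Bool
  isBargraph′ [] = false
  isBargraph′ (U ∷ w) = completes 1 U w
  isBargraph′ (H ∷ w) = false
  isBargraph′ (D ∷ w) = false

  noUDDU-cons : ∀ p s w → noUDDU (p ∷ s ∷ w) ≡ compatible p s ∧ noUDDU (s ∷ w)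
  noUDDU-cons U U w = refl
  noUDDU-cons U H w = refl
  noUDDU-cons U D w = refl
  noUDDU-cons H U w = refl
  noUDDU-cons H H w = refl
  noUDDU-cons H D w = refl
  noUDDU-cons D U w = refl
  noUDDU-cons D H w = refl
  noUDDU-cons D D w = refl

  noUDDU-one : ∀ p → noUDDU (p ∷ []) ≡ true
  noUDDU-one U = refl
  noUDDU-one H = refl
  noUDDU-one D = refl

  δ-nextHeight : ∀ h s → (+ suc h) ℤ.+ δ s ≡ + nextHeight (suc h) s
  δ-nextHeight h U = cong +_ (+-comm (suc h) 1)
  δ-nextHeight h H = cong +_ (+-identityʳ (suc h))
  δ-nextHeight h D = refl

  stays∧noUDDU≡completes : ∀ h p w → stays (+ h) w ∧ noUDDU (p ∷ w) ≡ completes h p w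
  stays∧noUDDU≡completes zero p [] rewrite noUDDU-one p = refl
  stays∧noUDDU≡completes (suc h) p [] = refl
  stays∧noUDDU≡completes zero p (s ∷ w) = refl
  stays∧noUDDU≡completes (suc h) p (s ∷ w) rewrite noUDDU-cons p s w | δ-nextHeight h s with compatible p s
  ... | true = stays∧noUDDU≡completes (nextHeight (suc h) s) s w
  ... | false = ∧-zeroʳ _

  isBargraph≡isBargraph′ : ∀ G → isBargraph G ≡ isBargraph′ G
  isBargraph≡isBargraph′ [] = refl
  isBargraph≡isBargraph′ (U ∷ []) = refl
  isBargraph≡isBargraph′ (H ∷ []) = refl
  isBargraph≡isBargraph′ (D ∷ []) = refl
  isBargraph≡isBargraph′ (U ∷ s ∷ w) = stays∧noUDDU≡completes 1 U (s ∷ w)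
  isBargraph≡isBargraph′ (H ∷ s ∷ w) = refl
  isBargraph≡isBargraph′ (D ∷ s ∷ w) = refl

  staysPositive : ℕ → Step → List Step → Bool
  staysPositive h p [] = true
  staysPositive zero p (s ∷ w) = false
  staysPositive (suc h) p (s ∷ w) = compatible p s ∧ staysPositive (nextHeight (suc h) s) s w

  heightAfter : ℕ → List Step → ℕ
  heightAfter h [] = h
  heightAfter h (s ∷ w) = heightAfter (nextHeight h s) w

  lastStep : Step → List Step → Step
  lastStep p [] = p
  lastStep p (s ∷ w) = lastStep s w

  completes-++ : ∀ h p w z → completes h p (w ++ z) ≡ staysPositive h p w ∧ completes (heightAfter h w) (lastStep p w) z
  completes-++ h p [] z = refl
  completes-++ zero p (s ∷ w) z = refl
  completes-++ (suc h) p (s ∷ w) z rewrite completes-++ (nextHeight (suc h) s) s w z =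
    sym (∧-assoc (compatible p s) _ _)

  completes-D : ∀ k q → completes k q (D ∷ []) ≡ (k ≡ᵇ 1) ∧ compatible q D
  completes-D zero q = refl
  completes-D (suc zero) q = ∧-identityʳ _
  completes-D (suc (suc k)) q = ∧-zeroʳ _

  completes-HD : ∀ k q → completes k q (H ∷ D ∷ []) ≡ (k ≡ᵇ 1)
  completes-HD zero q = refl
  completes-HD (suc zero) U = refl
  completes-HD (suc zero) H = refl
  completes-HD (suc zero) D = refl
  completes-HD (suc (suc k)) U = refl
  completes-HD (suc (suc k)) H = refl
  completes-HD (suc (suc k)) D = refl

  completes-single⇒D : ∀ k q s → completes k q (s ∷ []) ≡ true → s ≡ D
  completes-single⇒D (suc k) q U e rewrite ∧-zeroʳ (compatible q U) with e
  ... | ()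
  completes-single⇒D (suc k) q H e rewrite ∧-zeroʳ (compatible q H) with e
  ... | ()
  completes-single⇒D (suc k) q D e = refl

  ∧-true-left : ∀ {a b} → a ∧ b ≡ true → a ≡ true
  ∧-true-left {true} e = refl

  ∧-true-right : ∀ {a b} → a ∧ b ≡ true → b ≡ true
  ∧-true-right {true} e = e

  isBargraph′-snoc⇒D : ∀ w s → isBargraph′ (w ++ s ∷ []) ≡ true → s ≡ D
  isBargraph′-snoc⇒D [] U ()
  isBargraph′-snoc⇒D [] H ()
  isBargraph′-snoc⇒D [] D e = refl
  isBargraph′-snoc⇒D (U ∷ w) s e = completes-single⇒D (heightAfter 1 w) (lastStep U w) s
    (∧-true-right {staysPositive 1 U w} (trans (sym (completes-++ 1 U w (s ∷ []))) e))
  isBargraph′-snoc⇒D (H ∷ w) s ()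
  isBargraph′-snoc⇒D (D ∷ w) s ()


  #factorFrom : Step → Step → Step → List Step → ℕ
  #factorFrom a b p [] = 0
  #factorFrom a b p (s ∷ w) = ⟦ (s =ˢ b) ∧ (p =ˢ a) ⟧ + #factorFrom a b s w

  #factor≡#factorFrom : ∀ a b p w → #factor a b (p ∷ w) ≡ #factorFrom a b p w
  #factor≡#factorFrom a b p [] = refl
  #factor≡#factorFrom a b p (s ∷ w) rewrite #factor≡#factorFrom a b s w | ∧-comm (p =ˢ a) (s =ˢ b) = refl

  #factorFrom-++ : ∀ a b p w z → #factorFrom a b p (w ++ z) ≡ #factorFrom a b p w + #factorFrom a b (lastStep p w) z
  #factorFrom-++ a b p [] z = refl
  #factorFrom-++ a b p (s ∷ w) z rewrite #factorFrom-++ a b s w z = sym (+-assoc ⟦ (s =ˢ b) ∧ (p =ˢ a) ⟧ _ _)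

  count-++ : ∀ q w z → count q (w ++ z) ≡ count q w + count q z
  count-++ q [] z = refl
  count-++ q (s ∷ w) z rewrite count-++ q w z = sym (+-assoc (if q s then 1 else 0) _ _)

  vadd : ∀ {n} → Vec ℕ n → Vec ℕ n → Vec ℕ n
  vadd [] [] = []
  vadd (a ∷ v) (b ∷ w) = (a + b) ∷ vadd v w

  weight : List Step → Vec ℕ 4
  weight G = #DH G ∷ #UH G ∷ #H G ∷ #U G ∷ []

  yv : Vec ℕ 4
  yv = 0 ∷ 0 ∷ 0 ∷ 1 ∷ []

  cong-vec4 : ∀ {a a' b b' c c' d d' : ℕ} → a ≡ a' → b ≡ b' → c ≡ c' → d ≡ d' →
         _≡_ {A = Vec ℕ 4} (a ∷ b ∷ c ∷ d ∷ []) (a' ∷ b' ∷ c' ∷ d' ∷ [])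
  cong-vec4 refl refl refl refl = refl

  weight-raise : ∀ B' → weight (U ∷ ((U ∷ B') ++ D ∷ [])) ≡ vadd (weight (U ∷ B')) yv
  weight-raise B' = cong-vec4
    (trans (#factor≡#factorFrom D H U (B' ++ D ∷ []))
      (trans (#factorFrom-++ D H U B' (D ∷ [])) (cong (_+ 0) (sym (#factor≡#factorFrom D H U B')))))
    (trans (#factor≡#factorFrom U H U (B' ++ D ∷ []))
      (trans (#factorFrom-++ U H U B' (D ∷ [])) (cong (_+ 0) (sym (#factor≡#factorFrom U H U B')))))
    (count-++ isH B' (D ∷ []))
    (cong suc (trans (cong suc (trans (count-++ isU B' (D ∷ [])) (+-identityʳ _))) (+-comm 1 (count isU B'))))

  weight-glue : ∀ x' B' →
    weight (U ∷ x' ++ ((U ∷ B') ++ D ∷ [])) ≡ vadd (weight (U ∷ x' ++ D ∷ [])) (weight (U ∷ B'))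
  weight-glue x' B' = cong-vec4 c1 c2 c3 c4
    where
    c1 : #DH (U ∷ x' ++ ((U ∷ B') ++ D ∷ [])) ≡ #DH (U ∷ x' ++ D ∷ []) + #DH (U ∷ B')
    c1 rewrite #factor≡#factorFrom D H U (x' ++ ((U ∷ B') ++ D ∷ [])) | #factor≡#factorFrom D H U (x' ++ D ∷ [])
       | #factor≡#factorFrom D H U B' | #factorFrom-++ D H U x' ((U ∷ B') ++ D ∷ []) | #factorFrom-++ D H U x' (D ∷ [])
       | #factorFrom-++ D H U B' (D ∷ []) =
       solve 2 (λ a b → a :+ (b :+ con 0) := (a :+ con 0) :+ b) refl (#factorFrom D H U x') (#factorFrom D H U B')
    c2 : #UH (U ∷ x' ++ ((U ∷ B') ++ D ∷ [])) ≡ #UH (U ∷ x' ++ D ∷ []) + #UH (U ∷ B')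
    c2 rewrite #factor≡#factorFrom U H U (x' ++ ((U ∷ B') ++ D ∷ [])) | #factor≡#factorFrom U H U (x' ++ D ∷ [])
       | #factor≡#factorFrom U H U B' | #factorFrom-++ U H U x' ((U ∷ B') ++ D ∷ []) | #factorFrom-++ U H U x' (D ∷ [])
       | #factorFrom-++ U H U B' (D ∷ []) =
       solve 2 (λ a b → a :+ (b :+ con 0) := (a :+ con 0) :+ b) refl (#factorFrom U H U x') (#factorFrom U H U B')
    c3 : #H (U ∷ x' ++ ((U ∷ B') ++ D ∷ [])) ≡ #H (U ∷ x' ++ D ∷ []) + #H (U ∷ B')
    c3 rewrite count-++ isH x' ((U ∷ B') ++ D ∷ []) | count-++ isH x' (D ∷ [])
       | count-++ isH B' (D ∷ []) =
       solve 2 (λ a b → a :+ (b :+ con 0) := (a :+ con 0) :+ b) refl (count isH x') (count isH B')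
    c4 : #U (U ∷ x' ++ ((U ∷ B') ++ D ∷ [])) ≡ #U (U ∷ x' ++ D ∷ []) + #U (U ∷ B')
    c4 rewrite count-++ isU x' ((U ∷ B') ++ D ∷ []) | count-++ isU x' (D ∷ [])
       | count-++ isU B' (D ∷ []) =
       solve 2 (λ a b → con 1 :+ (a :+ (con 1 :+ (b :+ con 0))) := (con 1 :+ (a :+ con 0)) :+ (con 1 :+ b)) refl (count isU x') (count isU B')

  weight-widen : ∀ w' → weight (U ∷ w' ++ H ∷ D ∷ []) ≡
    vadd (weight (U ∷ w' ++ D ∷ [])) (⟦ lastStep U w' =ˢ D ⟧ ∷ ⟦ lastStep U w' =ˢ U ⟧ ∷ 1 ∷ 0 ∷ [])
  weight-widen w' = cong-vec4 c1 c2 c3 c4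
    where
    c1 : #DH (U ∷ w' ++ H ∷ D ∷ []) ≡ #DH (U ∷ w' ++ D ∷ []) + ⟦ lastStep U w' =ˢ D ⟧
    c1 rewrite #factor≡#factorFrom D H U (w' ++ H ∷ D ∷ []) | #factor≡#factorFrom D H U (w' ++ D ∷ [])
       | #factorFrom-++ D H U w' (H ∷ D ∷ []) | #factorFrom-++ D H U w' (D ∷ []) =
       solve 2 (λ a b → a :+ (b :+ con 0) := (a :+ con 0) :+ b) refl (#factorFrom D H U w') ⟦ lastStep U w' =ˢ D ⟧
    c2 : #UH (U ∷ w' ++ H ∷ D ∷ []) ≡ #UH (U ∷ w' ++ D ∷ []) + ⟦ lastStep U w' =ˢ U ⟧
    c2 rewrite #factor≡#factorFrom U H U (w' ++ H ∷ D ∷ []) | #factor≡#factorFrom U H U (w' ++ D ∷ [])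
       | #factorFrom-++ U H U w' (H ∷ D ∷ []) | #factorFrom-++ U H U w' (D ∷ []) =
       solve 2 (λ a b → a :+ (b :+ con 0) := (a :+ con 0) :+ b) refl (#factorFrom U H U w') ⟦ lastStep U w' =ˢ U ⟧
    c3 : #H (U ∷ w' ++ H ∷ D ∷ []) ≡ #H (U ∷ w' ++ D ∷ []) + 1
    c3 rewrite count-++ isH w' (H ∷ D ∷ []) | count-++ isH w' (D ∷ []) =
       solve 1 (λ a → a :+ (con 1 :+ con 0) := (a :+ con 0) :+ con 1) refl (count isH w')
    c4 : #U (U ∷ w' ++ H ∷ D ∷ []) ≡ #U (U ∷ w' ++ D ∷ []) + 0
    c4 rewrite count-++ isU w' (H ∷ D ∷ []) | count-++ isU w' (D ∷ []) = sym (+-identityʳ _)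


  endsHDFrom : Step → List Step → Bool
  endsHDFrom p [] = false
  endsHDFrom p (s ∷ []) = (p =ˢ H) ∧ (s =ˢ D)
  endsHDFrom p (s ∷ t ∷ w) = endsHDFrom s (t ∷ w)

  endsHD : List Step → Bool
  endsHD [] = false
  endsHD (s ∷ w) = endsHDFrom s w

  lastStepIsH : Step → List Step → Bool
  lastStepIsH p w = lastStep p w =ˢ H

  lastIsD : List Step → Bool
  lastIsD [] = false
  lastIsD (s ∷ []) = s =ˢ D
  lastIsD (s ∷ t ∷ w) = lastIsD (t ∷ w)

  dropLast : List Step → List Step
  dropLast [] = []
  dropLast (s ∷ []) = []
  dropLast (s ∷ t ∷ w) = s ∷ dropLast (t ∷ w)

  hasHAtHeight1 : ℕ → List Step → Bool
  hasHAtHeight1 h [] = false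
  hasHAtHeight1 h (s ∷ w) = ((s =ˢ H) ∧ (h ≡ᵇ 1)) ∨ hasHAtHeight1 (nextHeight h s) w

  isL isM : List Step → Bool
  isL G = isBargraph′ G ∧ endsHD G
  isM G = isBargraph′ G ∧ not (endsHD G)

  isBargraphThenD : List Step → Bool
  isBargraphThenD y = lastIsD y ∧ isBargraph′ (dropLast y)

  endsHDFrom-D : ∀ p x → endsHDFrom p (x ++ D ∷ []) ≡ lastStepIsH p x
  endsHDFrom-D p [] = ∧-identityʳ _
  endsHDFrom-D p (s ∷ []) = endsHDFrom-D s []
  endsHDFrom-D p (s ∷ t ∷ x) = endsHDFrom-D s (t ∷ x)

  endsHDFrom-HD : ∀ p x → endsHDFrom p (x ++ H ∷ D ∷ []) ≡ true
  endsHDFrom-HD p [] = refl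
  endsHDFrom-HD p (s ∷ []) = refl
  endsHDFrom-HD p (s ∷ t ∷ x) = endsHDFrom-HD s (t ∷ x)

  endsHDFrom-2 : ∀ p x a b → endsHDFrom p (x ++ a ∷ b ∷ []) ≡ (a =ˢ H) ∧ (b =ˢ D)
  endsHDFrom-2 p [] a b = refl
  endsHDFrom-2 p (s ∷ []) a b = refl
  endsHDFrom-2 p (s ∷ t ∷ x) a b = endsHDFrom-2 s (t ∷ x) a b

  endsHD-2 : ∀ x a b → endsHD (x ++ a ∷ b ∷ []) ≡ (a =ˢ H) ∧ (b =ˢ D)
  endsHD-2 [] a b = refl
  endsHD-2 (s ∷ x) a b = endsHDFrom-2 s x a b

  lastIsD-snoc : ∀ B z → lastIsD (B ++ z ∷ []) ≡ (z =ˢ D)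
  lastIsD-snoc [] z = refl
  lastIsD-snoc (s ∷ []) z = refl
  lastIsD-snoc (s ∷ t ∷ B) z = lastIsD-snoc (t ∷ B) z

  dropLast-snoc : ∀ B z → dropLast (B ++ z ∷ []) ≡ B
  dropLast-snoc [] z = refl
  dropLast-snoc (s ∷ []) z = refl
  dropLast-snoc (s ∷ t ∷ B) z = cong (s ∷_) (dropLast-snoc (t ∷ B) z)

  lastIsD⇒dropLast-++ : ∀ y → lastIsD y ≡ true → y ≡ dropLast y ++ D ∷ []
  lastIsD⇒dropLast-++ [] ()
  lastIsD⇒dropLast-++ (U ∷ []) ()
  lastIsD⇒dropLast-++ (H ∷ []) ()
  lastIsD⇒dropLast-++ (D ∷ []) e = refl
  lastIsD⇒dropLast-++ (s ∷ t ∷ y) e = cong (s ∷_) (lastIsD⇒dropLast-++ (t ∷ y) e)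

  ∨-true-left : ∀ a b → a ≡ true → a ∨ b ≡ true
  ∨-true-left true b e = refl

  ∧-dropMiddle : ∀ a {c} b → c ≡ true → a ∧ (c ∧ b) ≡ a ∧ b
  ∧-dropMiddle a b refl = refl

  completes-high-single : ∀ k p s → completes (suc (suc k)) p (s ∷ []) ≡ false
  completes-high-single k p U = ∧-zeroʳ _
  completes-high-single k p H = ∧-zeroʳ _
  completes-high-single k p D = ∧-zeroʳ _

  false≡true-elim : ∀ {A : Set} → false ≡ true → A
  false≡true-elim ()

  completes-dropLastD : ∀ k p w → completes (suc (suc k)) p w ≡ true →
       lastIsD w ∧ completes (suc k) p (dropLast w) ≡ not (hasHAtHeight1 (suc (suc k)) w)
  completes-dropLastD k p [] ()
  completes-dropLastD k p (s ∷ []) e = false≡true-elim (trans (sym (completes-high-single k p s)) e)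
  completes-dropLastD k p (U ∷ t ∷ w) e =
    trans (∧-dropMiddle (lastIsD (t ∷ w)) _ (∧-true-left {compatible p U} e))
          (completes-dropLastD (suc k) U (t ∷ w) (∧-true-right {compatible p U} e))
  completes-dropLastD k p (H ∷ t ∷ w) e =
    trans (∧-dropMiddle (lastIsD (t ∷ w)) _ (∧-true-left {compatible p H} e))
          (completes-dropLastD k H (t ∷ w) (∧-true-right {compatible p H} e))
  completes-dropLastD (suc k) p (D ∷ t ∷ w) e =
    trans (∧-dropMiddle (lastIsD (t ∷ w)) _ (∧-true-left {compatible p D} e))
          (completes-dropLastD k D (t ∷ w) (∧-true-right {compatible p D} e))
  completes-dropLastD zero p (D ∷ t ∷ w) e =
    trans (∧-dropMiddle (lastIsD (t ∷ w)) _ (∧-true-left {compatible p D} e))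
          (atHeight1 t w (∧-true-right {compatible p D} e))
    where
    atHeight1 : ∀ t w → completes 1 D (t ∷ w) ≡ true →
      lastIsD (t ∷ w) ∧ completes 0 D (dropLast (t ∷ w)) ≡ not (hasHAtHeight1 1 (t ∷ w))
    atHeight1 U w ()
    atHeight1 H [] e = refl
    atHeight1 H (u ∷ w) e = ∧-zeroʳ _
    atHeight1 D [] e = refl
    atHeight1 D (u ∷ w) ()

  endsHD⇒hasHAtHeight1 : ∀ h p w → completes h p w ≡ true → endsHDFrom p w ≡ true →
       (hasHAtHeight1 h w ∨ ((p =ˢ H) ∧ (h ≡ᵇ 1))) ≡ true
  endsHD⇒hasHAtHeight1 h p [] e ()
  endsHD⇒hasHAtHeight1 zero p (s ∷ []) () f
  endsHD⇒hasHAtHeight1 (suc zero) H (D ∷ []) e f = refl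
  endsHD⇒hasHAtHeight1 (suc (suc h)) H (D ∷ []) () f
  endsHD⇒hasHAtHeight1 (suc h) U (s ∷ []) e ()
  endsHD⇒hasHAtHeight1 (suc h) D (s ∷ []) e ()
  endsHD⇒hasHAtHeight1 (suc h) H (U ∷ []) e ()
  endsHD⇒hasHAtHeight1 (suc h) H (H ∷ []) e ()
  endsHD⇒hasHAtHeight1 zero p (s ∷ t ∷ w) () f
  endsHD⇒hasHAtHeight1 (suc h) p (H ∷ t ∷ w) e f =
    ∨-true-left ((suc h ≡ᵇ 1) ∨ hasHAtHeight1 (suc h) (t ∷ w)) _
      (trans (∨-comm (suc h ≡ᵇ 1) (hasHAtHeight1 (suc h) (t ∷ w)))
             (endsHD⇒hasHAtHeight1 (suc h) H (t ∷ w) (∧-true-right {compatible p H} e) f))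
  endsHD⇒hasHAtHeight1 (suc h) p (U ∷ t ∷ w) e f =
    ∨-true-left (hasHAtHeight1 (suc (suc h)) (t ∷ w)) _ (trans (sym (∨-identityʳ _))
      (endsHD⇒hasHAtHeight1 (suc (suc h)) U (t ∷ w) (∧-true-right {compatible p U} e) f))
  endsHD⇒hasHAtHeight1 (suc h) p (D ∷ t ∷ w) e f =
    ∨-true-left (hasHAtHeight1 h (t ∷ w)) _ (trans (sym (∨-identityʳ _))
      (endsHD⇒hasHAtHeight1 h D (t ∷ w) (∧-true-right {compatible p D} e) f))


  groundCut : ℕ → Step → List Step → List Step → ℕ
  groundCut h p x y = ⟦ (completes h p (x ++ D ∷ []) ∧ lastStepIsH p x) ∧ isBargraphThenD y ⟧

  #groundCuts : ℕ → Step → List Step → ℕ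
  #groundCuts h p w = sumCuts (groundCut h p) w

  hasGroundCut : ℕ → Step → List Step → Bool
  hasGroundCut h p w = (((p =ˢ H) ∧ (h ≡ᵇ 1)) ∨ hasHAtHeight1 h w) ∧ not (endsHDFrom p w)

  #groundCuts-step : ∀ h p s w → compatible p s ≡ true →
    sumCuts (λ x y → groundCut (suc h) p (s ∷ x) y) w ≡ #groundCuts (nextHeight (suc h) s) s w
  #groundCuts-step h p s w c = sumCuts-cong w (λ x y →
    cong (λ b → ⟦ ((b ∧ completes (nextHeight (suc h) s) s (x ++ D ∷ [])) ∧ lastStepIsH s x) ∧ isBargraphThenD y ⟧) c)

  iverson-implied : ∀ a e → (e ≡ true → a ∨ false ≡ true) → ⟦ not a ⟧ + ⟦ a ∧ not e ⟧ ≡ ⟦ not e ⟧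
  iverson-implied true true f = refl
  iverson-implied true false f = refl
  iverson-implied false true f with f refl
  ... | ()
  iverson-implied false false f = refl

  #groundCuts-head : ∀ h p s w → compatible p s ≡ true → completes (nextHeight (suc h) s) s w ≡ true →
        groundCut (suc h) p [] (s ∷ w) + ⟦ hasGroundCut (nextHeight (suc h) s) s w ⟧ ≡ ⟦ hasGroundCut (suc h) p (s ∷ w) ⟧
  #groundCuts-head h p U [] c ()
  #groundCuts-head h p H [] c ()
  #groundCuts-head (suc h) p D [] c ()
  #groundCuts-head zero U D [] () e
  #groundCuts-head zero H D [] c e = refl
  #groundCuts-head zero D D [] c e = refl
  #groundCuts-head h U U (t ∷ w) c e = refl
  #groundCuts-head h U H (t ∷ w) c e = refl
  #groundCuts-head h U D (t ∷ w) () e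
  #groundCuts-head h D U (t ∷ w) () e
  #groundCuts-head zero D H (t ∷ w) c e = refl
  #groundCuts-head (suc h) D H (t ∷ w) c e = refl
  #groundCuts-head zero D D (t ∷ w) c e = refl
  #groundCuts-head (suc h) D D (t ∷ w) c e = refl
  #groundCuts-head (suc h) H U (t ∷ w) c e = refl
  #groundCuts-head (suc h) H H (t ∷ w) c e = refl
  #groundCuts-head (suc h) H D (t ∷ w) c e = refl
  #groundCuts-head zero H D (t ∷ w) c ()
  #groundCuts-head zero H H (t ∷ w) c e rewrite ∧-zeroʳ (lastIsD (t ∷ w)) = refl
  #groundCuts-head zero H U (t ∷ w) c e rewrite completes-dropLastD 0 U (t ∷ w) e =
    iverson-implied (hasHAtHeight1 2 (t ∷ w)) (endsHDFrom U (t ∷ w)) (endsHD⇒hasHAtHeight1 2 U (t ∷ w) e)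

  -- A cut must sit right after the last H-step at height 1, so there is at most one.
  #groundCuts≡hasGroundCut : ∀ h p w → completes h p w ≡ true → #groundCuts h p w ≡ ⟦ hasGroundCut h p w ⟧
  #groundCuts≡hasGroundCut zero U [] e = refl
  #groundCuts≡hasGroundCut zero H [] e = refl
  #groundCuts≡hasGroundCut zero D [] e = refl
  #groundCuts≡hasGroundCut (suc h) p [] ()
  #groundCuts≡hasGroundCut zero p (s ∷ w) ()
  #groundCuts≡hasGroundCut (suc h) p (s ∷ w) e =
    trans (cong (λ z → groundCut (suc h) p [] (s ∷ w) + z)
            (trans (#groundCuts-step h p s w (∧-true-left {compatible p s} e))
                   (#groundCuts≡hasGroundCut (nextHeight (suc h) s) s w (∧-true-right {compatible p s} e))))
          (#groundCuts-head h p s w (∧-true-left {compatible p s} e) (∧-true-right {compatible p s} e))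

  ∧-intro-true : ∀ {a b} → a ≡ true → b ≡ true → a ∧ b ≡ true
  ∧-intro-true refl refl = refl

  completes-raise : ∀ h p s w → completes (suc h) p (s ∷ w) ≡ true →
    completes (suc (suc h)) p ((s ∷ w) ++ D ∷ []) ≡ true
  completes-raise h p U [] e = false≡true-elim (trans (sym (∧-zeroʳ (compatible p U))) e)
  completes-raise h p H [] e = false≡true-elim (trans (sym (∧-zeroʳ (compatible p H))) e)
  completes-raise (suc h) p D [] e = false≡true-elim (trans (sym (∧-zeroʳ (compatible p D))) e)
  completes-raise zero p D [] e = ∧-intro-true (trans (sym (∧-identityʳ _)) e) refl
  completes-raise h p U (t ∷ w) e =
    ∧-intro-true (∧-true-left {compatible p U} e) (completes-raise (suc h) U t w (∧-true-right {compatible p U} e))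
  completes-raise h p H (t ∷ w) e =
    ∧-intro-true (∧-true-left {compatible p H} e) (completes-raise h H t w (∧-true-right {compatible p H} e))
  completes-raise zero p D (t ∷ w) e = false≡true-elim (∧-true-right {compatible p D} e)
  completes-raise (suc h) p D (t ∷ w) e =
    ∧-intro-true (∧-true-left {compatible p D} e) (completes-raise h D t w (∧-true-right {compatible p D} e))

  isBargraphThenD⇒completes : ∀ q → compatible q U ≡ true → ∀ y → isBargraphThenD y ≡ true →
    completes 1 q y ≡ true
  isBargraphThenD⇒completes q c y e =
    subst (λ z → completes 1 q z ≡ true) (sym (lastIsD⇒dropLast-++ y (∧-true-left {lastIsD y} e)))
          (raised (dropLast y) (∧-true-right {lastIsD y} e))
    where
    raised : ∀ B → isBargraph′ B ≡ true → completes 1 q (B ++ D ∷ []) ≡ true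
    raised [] ()
    raised (H ∷ B) ()
    raised (D ∷ B) ()
    raised (U ∷ []) ()
    raised (U ∷ t ∷ B) b = ∧-intro-true c (completes-raise 0 U t B b)

  =ˢH⇒≡H : ∀ s → (s =ˢ H) ≡ true → s ≡ H
  =ˢH⇒≡H U ()
  =ˢH⇒≡H H e = refl
  =ˢH⇒≡H D ()

  completes-glue : ∀ h p x y → (completes h p (x ++ D ∷ []) ∧ lastStepIsH p x) ≡ true →
    isBargraphThenD y ≡ true → completes h p (x ++ y) ≡ true
  completes-glue h p x y e r =
    trans (completes-++ h p x y)
      (∧-intro-true x-staysPositive
        (subst₂ (λ k q → completes k q y ≡ true) (sym x-endsAtHeight1) (sym x-endsWithH)
                (isBargraphThenD⇒completes H refl y r)))
    where
    xD-splits : staysPositive h p x ∧ completes (heightAfter h x) (lastStep p x) (D ∷ []) ≡ true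
    xD-splits = trans (sym (completes-++ h p x (D ∷ []))) (∧-true-left {completes h p (x ++ D ∷ [])} e)
    x-staysPositive : staysPositive h p x ≡ true
    x-staysPositive = ∧-true-left {staysPositive h p x} xD-splits
    D-completes : (heightAfter h x ≡ᵇ 1) ∧ compatible (lastStep p x) D ≡ true
    D-completes = trans (sym (completes-D (heightAfter h x) (lastStep p x))) (∧-true-right {staysPositive h p x} xD-splits)
    x-endsAtHeight1 : heightAfter h x ≡ 1
    x-endsAtHeight1 = ≡ᵇ-true⇒≡ (heightAfter h x) 1 (∧-true-left {heightAfter h x ≡ᵇ 1} D-completes)
    x-endsWithH : lastStep p x ≡ H
    x-endsWithH = =ˢH⇒≡H (lastStep p x) (∧-true-right {completes h p (x ++ D ∷ [])} e)

  isRaised : List Step → ℕ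
  isRaised (U ∷ w) = ⟦ isBargraphThenD w ⟧
  isRaised _ = 0

  gluedAt : List Step → List Step → ℕ
  gluedAt x y = ⟦ isL (x ++ D ∷ []) ∧ isBargraphThenD y ⟧

  bool-cases : ∀ (b : Bool) {c : Set} → (b ≡ true → c) → (b ≡ false → c) → c
  bool-cases true t f = t refl
  bool-cases false t f = f refl

  isBargraphThenD-H : ∀ w → isBargraphThenD (H ∷ w) ≡ false
  isBargraphThenD-H [] = refl
  isBargraphThenD-H (t ∷ w) = ∧-zeroʳ _

  iverson-three : ∀ a e → (e ≡ true → a ∨ false ≡ true) → 1 ≡ ⟦ not a ⟧ + (⟦ e ⟧ + ⟦ a ∧ not e ⟧)
  iverson-three true true f = refl
  iverson-three true false f = refl
  iverson-three false true f with f refl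
  ... | ()
  iverson-three false false f = refl

  iverson-two : ∀ e → 1 ≡ 0 + (⟦ e ⟧ + ⟦ not e ⟧)
  iverson-two true = refl
  iverson-two false = refl

  isBargraph′-firstColumn : ∀ G → ⟦ isBargraph′ G ⟧ ≡ isRaised G + (⟦ isL G ⟧ + sumCuts gluedAt G)
  isBargraph′-firstColumn [] = refl
  isBargraph′-firstColumn (H ∷ w) = sym (sumCuts-zero w _ (λ _ _ _ → refl))
  isBargraph′-firstColumn (D ∷ w) = sym (sumCuts-zero w _ (λ _ _ _ → refl))
  isBargraph′-firstColumn (U ∷ w) =
    trans (byValidity (completes 1 U w) refl)
          (cong (λ z → ⟦ isBargraphThenD w ⟧ + (⟦ completes 1 U w ∧ endsHDFrom U w ⟧ + z)) (sym gluedAt≡groundCut))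
    where
    gluedAt≡groundCut : sumCuts gluedAt (U ∷ w) ≡ #groundCuts 1 U w
    gluedAt≡groundCut = sumCuts-cong w (λ x y →
      cong (λ b → ⟦ (completes 1 U (x ++ D ∷ []) ∧ b) ∧ isBargraphThenD y ⟧) (endsHDFrom-D U x))
    exactlyOne : ∀ w → completes 1 U w ≡ true →
      1 ≡ ⟦ isBargraphThenD w ⟧ + (⟦ true ∧ endsHDFrom U w ⟧ + ⟦ hasGroundCut 1 U w ⟧)
    exactlyOne [] ()
    exactlyOne (D ∷ w) ()
    exactlyOne (H ∷ w) e rewrite isBargraphThenD-H w = iverson-two (endsHDFrom U (H ∷ w))
    exactlyOne (U ∷ []) ()
    exactlyOne (U ∷ t ∷ w) e rewrite completes-dropLastD 0 U (t ∷ w) e =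
      iverson-three (hasHAtHeight1 2 (t ∷ w)) (endsHDFrom U (t ∷ w)) (endsHD⇒hasHAtHeight1 2 U (t ∷ w) e)
    byValidity : ∀ b → completes 1 U w ≡ b →
      ⟦ b ⟧ ≡ ⟦ isBargraphThenD w ⟧ + (⟦ completes 1 U w ∧ endsHDFrom U w ⟧ + #groundCuts 1 U w)
    byValidity true e rewrite #groundCuts≡hasGroundCut 1 U w e | e = exactlyOne w e
    byValidity false e rewrite e = sym (cong₂ _+_ notRaised noGroundCut)
      where
      notRaised : ⟦ isBargraphThenD w ⟧ ≡ 0
      notRaised = bool-cases (isBargraphThenD w)
        (λ r → false≡true-elim (trans (sym e) (isBargraphThenD⇒completes U refl w r)))
        (cong ⟦_⟧)
      noGroundCut : #groundCuts 1 U w ≡ 0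
      noGroundCut = sumCuts-zero w (groundCut 1 U) (λ x y xy →
        bool-cases ((completes 1 U (x ++ D ∷ []) ∧ lastStepIsH U x) ∧ isBargraphThenD y)
          (λ t → false≡true-elim (trans (sym e) (subst (λ z → completes 1 U z ≡ true) xy
             (completes-glue 1 U x y (∧-true-left {completes 1 U (x ++ D ∷ []) ∧ lastStepIsH U x} t)
                                     (∧-true-right {completes 1 U (x ++ D ∷ []) ∧ lastStepIsH U x} t)))))
          (cong ⟦_⟧))

  eqV : ∀ {n} → Vec ℕ n → Vec ℕ n → Bool
  eqV [] [] = true
  eqV (a ∷ v) (b ∷ w) = (a ≡ᵇ b) ∧ eqV v w

  xv txv sxyv : Vec ℕ 4
  xv = 0 ∷ 0 ∷ 1 ∷ 0 ∷ []
  txv = 1 ∷ 0 ∷ 1 ∷ 0 ∷ []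
  sxyv = 0 ∷ 1 ∷ 1 ∷ 1 ∷ []

  isSingleU : List Step → Bool
  isSingleU (U ∷ []) = true
  isSingleU _ = false

  lastStep-U⇒[] : ∀ h p w → staysPositive h p w ≡ true → lastStep p w ≡ U → heightAfter h w ≡ 1 → w ≡ []
  lastStep-U⇒[] h p [] a b c = refl
  lastStep-U⇒[] zero p (s ∷ w) () b c
  lastStep-U⇒[] (suc h) p (s ∷ w) a b c with lastStep-U⇒[] (nextHeight (suc h) s) s w (∧-true-right {compatible p s} a) b c
  lastStep-U⇒[] (suc h) p (U ∷ w) a b () | refl
  lastStep-U⇒[] (suc h) p (H ∷ w) a () c | refl
  lastStep-U⇒[] (suc h) p (D ∷ w) a () c | refl

  lastColumn-cases : ∀ (q : Step) (P K : Bool) (W0 : Vec ℕ 4) v → (q ≡ U → P ≡ true → K ≡ true → ⊥) →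
    ⟦ (P ∧ K) ∧ eqV (vadd W0 (⟦ q =ˢ D ⟧ ∷ ⟦ q =ˢ U ⟧ ∷ 1 ∷ 0 ∷ [])) v ⟧ ≡
    ⟦ false ⟧ + (⟦ ((P ∧ (K ∧ compatible q D)) ∧ (q =ˢ H)) ∧ eqV (vadd W0 xv) v ⟧ +
                 ⟦ ((P ∧ (K ∧ compatible q D)) ∧ not (q =ˢ H)) ∧ eqV (vadd W0 txv) v ⟧)
  lastColumn-cases U true true W0 v f = ⊥-elim (f refl refl refl)
  lastColumn-cases U true false W0 v f = refl
  lastColumn-cases U false K W0 v f = refl
  lastColumn-cases H true true W0 v f = sym (+-identityʳ _)
  lastColumn-cases H true false W0 v f = refl
  lastColumn-cases H false K W0 v f = refl
  lastColumn-cases D true true W0 v f = refl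
  lastColumn-cases D true false W0 v f = refl
  lastColumn-cases D false K W0 v f = refl

  isL-lastColumn : ∀ w v → ⟦ isL (w ++ H ∷ D ∷ []) ∧ eqV (weight (w ++ H ∷ D ∷ [])) v ⟧ ≡
    ⟦ isSingleU w ∧ eqV (weight (w ++ H ∷ D ∷ [])) v ⟧ +
    (⟦ isL (w ++ D ∷ []) ∧ eqV (vadd (weight (w ++ D ∷ [])) xv) v ⟧ +
     ⟦ isM (w ++ D ∷ []) ∧ eqV (vadd (weight (w ++ D ∷ [])) txv) v ⟧)
  isL-lastColumn [] v = refl
  isL-lastColumn (H ∷ w) v = refl
  isL-lastColumn (D ∷ w) v = refl
  isL-lastColumn (U ∷ []) v = sym (+-identityʳ _)
  isL-lastColumn (U ∷ s ∷ w) v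
    rewrite endsHDFrom-HD U (s ∷ w) | endsHDFrom-D U (s ∷ w)
          | completes-++ 1 U (s ∷ w) (H ∷ D ∷ []) | completes-++ 1 U (s ∷ w) (D ∷ [])
          | completes-HD (heightAfter 1 (s ∷ w)) (lastStep U (s ∷ w)) | completes-D (heightAfter 1 (s ∷ w)) (lastStep U (s ∷ w))
          | weight-widen (s ∷ w) | ∧-identityʳ (staysPositive 1 U (s ∷ w) ∧ (heightAfter 1 (s ∷ w) ≡ᵇ 1)) =
    lastColumn-cases (lastStep U (s ∷ w)) (staysPositive 1 U (s ∷ w)) (heightAfter 1 (s ∷ w) ≡ᵇ 1) (weight (U ∷ (s ∷ w) ++ D ∷ [])) v
      (λ a b c → case (lastStep-U⇒[] 1 U (s ∷ w) b a (≡ᵇ-true⇒≡ (heightAfter 1 (s ∷ w)) 1 c)))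
    where
    case : ∀ {A : Set} → _≡_ {A = List Step} (s ∷ w) [] → A
    case ()

module SeriesAlgebra where

  open BargraphWalks using (eqV; vadd; false≡true-elim)
  open WordSums using (sumMap; ≡ᵇ-true⇒≡; ≡ᵇ-refl)
  open import Data.Nat as ℕ using (ℕ; zero; suc; _∸_; _≡ᵇ_)
  import Data.Nat.Properties as NP
  open import Data.Integer as ℤ using (ℤ; +_; 0ℤ; 1ℤ; _+_; _*_; -_; _-_)
  open import Data.Integer.Properties
  open import Algebra.Properties.CommutativeSemigroup +-commutativeSemigroup using (interchange)
  open import Data.List using (List; []; _∷_; _++_; map; concatMap; upTo; foldr; applyUpTo)
  open import Data.Vec using (Vec; []; _∷_; replicate)
  open import Data.Product using (_,_; proj₁; proj₂)
  open import Data.Maybe using (Maybe; just; nothing)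
  open import Data.Bool using (Bool; true; false; if_then_else_; _∧_)
  open import Relation.Binary.PropositionalEquality
  open import Function using (_∘_; id)

  leq : ℕ → ℕ → Bool
  leq zero n = true
  leq (suc m) zero = false
  leq (suc m) (suc n) = leq m n

  consIf : ∀ {n} → Bool → ℕ → Maybe (Vec ℕ n) → Maybe (Vec ℕ (suc n))
  consIf false a r = nothing
  consIf true a nothing = nothing
  consIf true a (just p) = just (a ∷ p)

  sub? : ∀ {n} → Vec ℕ n → Vec ℕ n → Maybe (Vec ℕ n)
  sub? [] [] = just []
  sub? (m ∷ v) (e ∷ es) = consIf (leq e m) (m ∸ e) (sub? v es)

  maybe0 : ∀ {A : Set} → Maybe A → (A → ℤ) → ℤ
  maybe0 nothing f = 0ℤ
  maybe0 (just x) f = f x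

  -- multiplication by the monomial with exponent e (coefficients below e are 0)
  shift : ∀ {n} → Vec ℕ n → Series n → Series n
  shift e f v = maybe0 (sub? v e) f

  sumℤ : {A : Set} → List A → (A → ℤ) → ℤ
  sumℤ [] g = 0ℤ
  sumℤ (x ∷ l) g = g x + sumℤ l g

  foldr-map≡sumℤ : ∀ {A : Set} (l : List A) (g : A → ℤ) → foldr _+_ 0ℤ (map g l) ≡ sumℤ l g
  foldr-map≡sumℤ [] g = refl
  foldr-map≡sumℤ (x ∷ l) g = cong (_+_ (g x)) (foldr-map≡sumℤ l g)

  sumℤ-cong : ∀ {A : Set} (l : List A) {f g : A → ℤ} → (∀ x → f x ≡ g x) → sumℤ l f ≡ sumℤ l g
  sumℤ-cong [] e = refl
  sumℤ-cong (x ∷ l) e = cong₂ _+_ (e x) (sumℤ-cong l e)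

  sumℤ-++ : ∀ {A : Set} (l l' : List A) (g : A → ℤ) → sumℤ (l ++ l') g ≡ sumℤ l g + sumℤ l' g
  sumℤ-++ [] l' g = sym (+-identityˡ _)
  sumℤ-++ (x ∷ l) l' g rewrite sumℤ-++ l l' g = sym (+-assoc (g x) _ _)

  sumℤ-concatMap : ∀ {A B : Set} (k : A → List B) (l : List A) (g : B → ℤ) →
    sumℤ (concatMap k l) g ≡ sumℤ l (λ a → sumℤ (k a) g)
  sumℤ-concatMap k [] g = refl
  sumℤ-concatMap k (a ∷ l) g = trans (sumℤ-++ (k a) (concatMap k l) g) (cong (_+_ (sumℤ (k a) g)) (sumℤ-concatMap k l g))

  sumℤ-map : ∀ {A B : Set} (k : A → B) (l : List A) (g : B → ℤ) → sumℤ (map k l) g ≡ sumℤ l (g ∘ k)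
  sumℤ-map k [] g = refl
  sumℤ-map k (a ∷ l) g = cong (_+_ (g (k a))) (sumℤ-map k l g)

  sumℤ-+ : ∀ {A : Set} (l : List A) (f g : A → ℤ) → sumℤ l (λ x → f x + g x) ≡ sumℤ l f + sumℤ l g
  sumℤ-+ [] f g = refl
  sumℤ-+ (x ∷ l) f g rewrite sumℤ-+ l f g = interchange (f x) (g x) (sumℤ l f) (sumℤ l g)

  sumℤ-neg : ∀ {A : Set} (l : List A) (f : A → ℤ) → sumℤ l (λ x → - f x) ≡ - sumℤ l f
  sumℤ-neg [] f = refl
  sumℤ-neg (x ∷ l) f rewrite sumℤ-neg l f = sym (neg-distrib-+ (f x) (sumℤ l f))

  sumℤ-zero : ∀ {A : Set} (l : List A) (f : A → ℤ) → (∀ x → f x ≡ 0ℤ) → sumℤ l f ≡ 0ℤ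
  sumℤ-zero [] f e = refl
  sumℤ-zero (x ∷ l) f e rewrite e x | sumℤ-zero l f e = refl

  sumℤ-pos : ∀ {A : Set} (l : List A) (f : A → ℕ) → sumℤ l (λ x → + f x) ≡ + sumMap l f
  sumℤ-pos [] f = refl
  sumℤ-pos (x ∷ l) f rewrite sumℤ-pos l f = sym (pos-+ (f x) (sumMap l f))

  sumBelow : ℕ → (ℕ → ℤ) → ℤ
  sumBelow zero g = 0ℤ
  sumBelow (suc n) g = g 0 + sumBelow n (g ∘ suc)

  sumℤ-applyUpTo : ∀ (f : ℕ → ℕ) n (g : ℕ → ℤ) → sumℤ (applyUpTo f n) g ≡ sumBelow n (λ i → g (f i))
  sumℤ-applyUpTo f zero g = refl
  sumℤ-applyUpTo f (suc n) g = cong (_+_ (g (f 0))) (sumℤ-applyUpTo (f ∘ suc) n g)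

  sumBelow-cong : ∀ n {f g : ℕ → ℤ} → (∀ i → ℕ._<_ i n → f i ≡ g i) → sumBelow n f ≡ sumBelow n g
  sumBelow-cong zero e = refl
  sumBelow-cong (suc n) e = cong₂ _+_ (e 0 (ℕ.s≤s ℕ.z≤n)) (sumBelow-cong n (λ i lt → e (suc i) (ℕ.s≤s lt)))

  sumBelow-zero : ∀ n (f : ℕ → ℤ) → (∀ i → f i ≡ 0ℤ) → sumBelow n f ≡ 0ℤ
  sumBelow-zero zero f e = refl
  sumBelow-zero (suc n) f e rewrite e 0 | sumBelow-zero n (f ∘ suc) (e ∘ suc) = refl

  sumBelow-+ : ∀ n (f g : ℕ → ℤ) → sumBelow n (λ b → f b + g b) ≡ sumBelow n f + sumBelow n g
  sumBelow-+ zero f g = refl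
  sumBelow-+ (suc n) f g rewrite sumBelow-+ n (λ x → f (suc x)) (λ x → g (suc x)) =
    interchange (f 0) (g 0) (sumBelow n (λ x → f (suc x))) (sumBelow n (λ x → g (suc x)))

  sumBelow-neg : ∀ n (f : ℕ → ℤ) → sumBelow n (λ b → - f b) ≡ - sumBelow n f
  sumBelow-neg zero f = refl
  sumBelow-neg (suc n) f rewrite sumBelow-neg n (λ x → f (suc x)) = sym (neg-distrib-+ (f 0) _)

  sumBelow-− : ∀ n (f g : ℕ → ℤ) → sumBelow n (λ b → f b - g b) ≡ sumBelow n f - sumBelow n g
  sumBelow-− n f g = trans (sumBelow-+ n f (λ b → - g b)) (cong (_+_ (sumBelow n f)) (sumBelow-neg n g))

  sumSplits : ∀ {n} → Vec ℕ n → (Vec ℕ n → Vec ℕ n → ℤ) → ℤ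
  sumSplits v F = sumℤ (splits v) (λ pq → F (proj₁ pq) (proj₂ pq))

  ⊗≡sumSplits : ∀ {n} (f g : Series n) v → (f ⊗ g) v ≡ sumSplits v (λ p q → f p * g q)
  ⊗≡sumSplits f g v = trans (foldr-map≡sumℤ (splits v) _) (sumℤ-cong (splits v) (λ _ → refl))

  sumSplits-cons : ∀ {n} m (v : Vec ℕ n) F →
    sumSplits (m ∷ v) F ≡ sumBelow (suc m) (λ i → sumSplits v (λ p q → F (i ∷ p) ((m ∸ i) ∷ q)))
  sumSplits-cons m v F = trans overUpTo (sumℤ-applyUpTo id (suc m) (λ i → sumSplits v (λ p q → F (i ∷ p) ((m ∸ i) ∷ q))))
    where
    prepend : ℕ → Vec ℕ _ × Vec ℕ _ → Vec ℕ _ × Vec ℕ _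
    prepend i (p , q) = i ∷ p , (m ∸ i) ∷ q
    overUpTo : sumSplits (m ∷ v) F ≡ sumℤ (upTo (suc m)) (λ i → sumSplits v (λ p q → F (i ∷ p) ((m ∸ i) ∷ q)))
    overUpTo = trans (sumℤ-concatMap (λ i → map (prepend i) (splits v)) (upTo (suc m)) _)
                     (sumℤ-cong (upTo (suc m)) (λ i → sumℤ-map (prepend i) (splits v) (λ pq → F (proj₁ pq) (proj₂ pq))))

  sumSplits-cong : ∀ {n} (v : Vec ℕ n) {F G : Vec ℕ n → Vec ℕ n → ℤ} →
    (∀ p q → vadd p q ≡ v → F p q ≡ G p q) → sumSplits v F ≡ sumSplits v G
  sumSplits-cong [] e = cong (_+ 0ℤ) (e [] [] refl)
  sumSplits-cong (m ∷ v) {F} {G} e =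
    trans (sumSplits-cons m v F) (trans (sumBelow-cong (suc m) (λ i lt →
      sumSplits-cong v (λ p q pq → e (i ∷ p) ((m ∸ i) ∷ q)
        (cong₂ _∷_ (NP.m+[n∸m]≡n (NP.≤-pred lt)) pq))))
     (sym (sumSplits-cons m v G)))

  sumSplits-+ : ∀ {n} (v : Vec ℕ n) F G → sumSplits v (λ p q → F p q + G p q) ≡ sumSplits v F + sumSplits v G
  sumSplits-+ v F G = sumℤ-+ (splits v) _ _

  sumSplits-neg : ∀ {n} (v : Vec ℕ n) F → sumSplits v (λ p q → - F p q) ≡ - sumSplits v F
  sumSplits-neg v F = sumℤ-neg (splits v) _

  sumSplits-zero : ∀ {n} (v : Vec ℕ n) F → (∀ p q → F p q ≡ 0ℤ) → sumSplits v F ≡ 0ℤ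
  sumSplits-zero v F e = sumℤ-zero (splits v) _ (λ pq → e (proj₁ pq) (proj₂ pq))

  sumSplits-pos : ∀ {n} (v : Vec ℕ n) (F : Vec ℕ n → Vec ℕ n → ℕ) →
    sumSplits v (λ p q → + F p q) ≡ + sumMap (splits v) (λ pq → F (proj₁ pq) (proj₂ pq))
  sumSplits-pos v F = sumℤ-pos (splits v) _

  maybe0-consIf : ∀ {n} a (r : Maybe (Vec ℕ n)) (f : Vec ℕ (suc n) → ℤ) →
    maybe0 (consIf true a r) f ≡ maybe0 r (λ p → f (a ∷ p))
  maybe0-consIf a nothing f = refl
  maybe0-consIf a (just p) f = refl

  maybe0-cong : ∀ {A : Set} (r : Maybe A) {f g : A → ℤ} → (∀ x → f x ≡ g x) → maybe0 r f ≡ maybe0 r g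
  maybe0-cong nothing e = refl
  maybe0-cong (just x) e = e x

  maybe0-zero : ∀ {A : Set} (r : Maybe A) → maybe0 r (λ _ → 0ℤ) ≡ 0ℤ
  maybe0-zero nothing = refl
  maybe0-zero (just x) = refl

  maybe0-sumBelow : ∀ {A : Set} (r : Maybe A) n (g : A → ℕ → ℤ) →
    maybe0 r (λ x → sumBelow n (g x)) ≡ sumBelow n (λ j → maybe0 r (λ x → g x j))
  maybe0-sumBelow nothing n g = sym (sumBelow-zero n _ (λ _ → refl))
  maybe0-sumBelow (just x) n g = refl

  sumBelow-shift : ∀ e m (A : ℕ → ℕ → ℤ) →
    sumBelow (suc m) (λ i → if leq e i then A (i ∸ e) (m ∸ i) else 0ℤ)
    ≡ (if leq e m then sumBelow (suc (m ∸ e)) (λ j → A j (m ∸ e ∸ j)) else 0ℤ)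
  sumBelow-shift zero m A = refl
  sumBelow-shift (suc e) zero A = refl
  sumBelow-shift (suc e) (suc m) A = trans (+-identityˡ _) (sumBelow-shift e m A)

  sumBelow-indicator : ∀ e m (B : ℕ → ℤ) →
    sumBelow (suc m) (λ i → if i ≡ᵇ e then B i else 0ℤ) ≡ (if leq e m then B e else 0ℤ)
  sumBelow-indicator zero m B = trans (cong (_+_ (B 0)) (sumBelow-zero m _ (λ _ → refl))) (+-identityʳ _)
  sumBelow-indicator (suc e) zero B = refl
  sumBelow-indicator (suc e) (suc m) B = trans (+-identityˡ _) (sumBelow-indicator e m (B ∘ suc))

  sumSplits-if : ∀ {n} (b : Bool) (v : Vec ℕ n) G →
    sumSplits v (λ p q → if b then G p q else 0ℤ) ≡ (if b then sumSplits v G else 0ℤ)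
  sumSplits-if true v G = refl
  sumSplits-if false v G = sumSplits-zero v _ (λ _ _ → refl)

  if-consIf : ∀ {n} (b : Bool) a (r : Maybe (Vec ℕ n)) (f : Vec ℕ (suc n) → ℤ) X →
    X ≡ maybe0 (consIf true a r) f → (if b then X else 0ℤ) ≡ maybe0 (consIf b a r) f
  if-consIf true a r f X e = e
  if-consIf false a r f X e = refl

  sumSplits-shift : ∀ {n} (v e : Vec ℕ n) (F : Vec ℕ n → Vec ℕ n → ℤ) →
    sumSplits v (λ p q → maybe0 (sub? p e) (λ p' → F p' q)) ≡ maybe0 (sub? v e) (λ v' → sumSplits v' F)
  sumSplits-shift [] [] F = refl
  sumSplits-shift (m ∷ v) (e0 ∷ e') F =
    trans (sumSplits-cons m v _)
     (trans (sumBelow-cong (suc m) (λ i _ → term i))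
      (trans (sumBelow-shift e0 m A)
       (if-consIf (leq e0 m) (m ∸ e0) (sub? v e') (λ v'' → sumSplits v'' F) _
          (sym (trans (maybe0-consIf (m ∸ e0) (sub? v e') (λ v'' → sumSplits v'' F))
            (trans (maybe0-cong (sub? v e') (λ v' → sumSplits-cons (m ∸ e0) v' F))
                   (maybe0-sumBelow (sub? v e') (suc (m ∸ e0))
                      (λ v' j → sumSplits v' (λ p q → F (j ∷ p) ((m ∸ e0 ∸ j) ∷ q))))))))))
    where
    A : ℕ → ℕ → ℤ
    A j k = maybe0 (sub? v e') (λ v' → sumSplits v' (λ p' q → F (j ∷ p') (k ∷ q)))
    term : ∀ i → sumSplits v (λ p q → maybe0 (consIf (leq e0 i) (i ∸ e0) (sub? p e')) (λ p' → F p' ((m ∸ i) ∷ q)))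
               ≡ (if leq e0 i then A (i ∸ e0) (m ∸ i) else 0ℤ)
    term i with leq e0 i
    ... | false = sumSplits-zero v _ (λ _ _ → refl)
    ... | true = trans (sumSplits-cong v (λ p q _ → maybe0-consIf (i ∸ e0) (sub? p e') _))
                       (sumSplits-shift v e' (λ p' q → F ((i ∸ e0) ∷ p') ((m ∸ i) ∷ q)))

  indℤ : Bool → ℤ
  indℤ b = if b then 1ℤ else 0ℤ

  indℤ-∧-* : ∀ a b (X : ℤ) → indℤ (a ∧ b) * X ≡ (if a then indℤ b * X else 0ℤ)
  indℤ-∧-* true b X = refl
  indℤ-∧-* false b X = refl

  sumSplits-indicator : ∀ {n} (v e : Vec ℕ n) (F : Vec ℕ n → ℤ) →
    sumSplits v (λ p q → indℤ (eqV p e) * F q) ≡ maybe0 (sub? v e) F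
  sumSplits-indicator [] [] F = trans (+-identityʳ _) (*-identityˡ (F []))
  sumSplits-indicator (m ∷ v) (e0 ∷ e') F =
    trans (sumSplits-cons m v _)
     (trans (sumBelow-cong (suc m) (λ i _ → term i))
      (trans (sumBelow-indicator e0 m (λ i → maybe0 (sub? v e') (λ q → F ((m ∸ i) ∷ q))))
       (if-consIf (leq e0 m) (m ∸ e0) (sub? v e') F _ (sym (maybe0-consIf (m ∸ e0) (sub? v e') F)))))
    where
    term : ∀ i → sumSplits v (λ p q → indℤ ((i ≡ᵇ e0) ∧ eqV p e') * F ((m ∸ i) ∷ q))
               ≡ (if i ≡ᵇ e0 then maybe0 (sub? v e') (λ q → F ((m ∸ i) ∷ q)) else 0ℤ)
    term i = trans (sumSplits-cong v (λ p q _ → indℤ-∧-* (i ≡ᵇ e0) (eqV p e') _))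
              (trans (sumSplits-if (i ≡ᵇ e0) v _)
                     (cong (λ z → if i ≡ᵇ e0 then z else 0ℤ) (sumSplits-indicator v e' (λ q → F ((m ∸ i) ∷ q)))))

  open import Relation.Nullary.Decidable using (dec-true; dec-false)
  open import Data.Vec.Properties using (≡-dec)

  eqV⇒≡ : ∀ {n} (v e : Vec ℕ n) → eqV v e ≡ true → v ≡ e
  eqV⇒≡ [] [] t = refl
  eqV⇒≡ (a ∷ v) (b ∷ e) t with a ≡ᵇ b in ab
  ... | true = cong₂ _∷_ (≡ᵇ-true⇒≡ a b ab) (eqV⇒≡ v e t)
  ... | false with t
  ... | ()

  eqV-refl : ∀ {n} (v : Vec ℕ n) → eqV v v ≡ true
  eqV-refl [] = refl
  eqV-refl (a ∷ v) rewrite ≡ᵇ-refl a = eqV-refl v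

  mono≡indℤ : ∀ {n} (e v : Vec ℕ n) → mono e v ≡ indℤ (eqV v e)
  mono≡indℤ e v with eqV v e in eq
  ... | true rewrite dec-true (≡-dec ℕ._≟_ v e) (eqV⇒≡ v e eq) = refl
  ... | false rewrite dec-false (≡-dec ℕ._≟_ v e)
          (λ ve → false≡true-elim (trans (sym eq) (subst (λ z → eqV v z ≡ true) ve (eqV-refl v)))) = refl

  mono⊗≡shift : ∀ {n} (e : Vec ℕ n) (f : Series n) v → (mono e ⊗ f) v ≡ shift e f v
  mono⊗≡shift e f v =
    trans (⊗≡sumSplits (mono e) f v)
          (trans (sumSplits-cong v (λ p q _ → cong (_* f q) (mono≡indℤ e p))) (sumSplits-indicator v e f))

  sub?-zero : ∀ {n} (v : Vec ℕ n) → sub? v (replicate n 0) ≡ just v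
  sub?-zero [] = refl
  sub?-zero (m ∷ v) rewrite sub?-zero v = refl

  𝟙⊗ : ∀ {n} (f : Series n) v → (𝟙 ⊗ f) v ≡ f v
  𝟙⊗ {n} f v = trans (mono⊗≡shift (replicate n 0) f v) (cong (λ r → maybe0 r f) (sub?-zero v))

  ⊗-congˡ : ∀ {n} {f f' : Series n} (g : Series n) v → (∀ p → f p ≡ f' p) → (f ⊗ g) v ≡ (f' ⊗ g) v
  ⊗-congˡ {f = f} {f'} g v e =
    trans (⊗≡sumSplits f g v)
          (trans (sumSplits-cong v (λ p q _ → cong (_* g q) (e p))) (sym (⊗≡sumSplits f' g v)))

  ⊗-distribʳ-⊕ : ∀ {n} (f g h : Series n) v → ((f ⊕ g) ⊗ h) v ≡ (f ⊗ h) v + (g ⊗ h) v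
  ⊗-distribʳ-⊕ f g h v = trans (⊗≡sumSplits (f ⊕ g) h v) (trans (sumSplits-cong v (λ p q _ → *-distribʳ-+ (h q) (f p) (g p)))
    (trans (sumSplits-+ v _ _) (sym (cong₂ _+_ (⊗≡sumSplits f h v) (⊗≡sumSplits g h v)))))

  ⊗-distribʳ-⊖ : ∀ {n} (f g h : Series n) v → ((f ⊖ g) ⊗ h) v ≡ (f ⊗ h) v - (g ⊗ h) v
  ⊗-distribʳ-⊖ f g h v = trans (⊗≡sumSplits (f ⊖ g) h v) (trans (sumSplits-cong v (λ p q _ →
      trans (*-distribʳ-+ (h q) (f p) (- g p)) (cong (_+_ (f p * h q)) (sym (neg-distribˡ-* (g p) (h q))))))
    (trans (sumSplits-+ v _ _) (trans (cong (_+_ (sumSplits v (λ p q → f p * h q))) (sumSplits-neg v _))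
      (sym (cong₂ _-_ (⊗≡sumSplits f h v) (⊗≡sumSplits g h v))))))

  maybe0-* : ∀ {A : Set} (r : Maybe A) (f : A → ℤ) c → maybe0 r f * c ≡ maybe0 r (λ x → f x * c)
  maybe0-* nothing f c = refl
  maybe0-* (just x) f c = refl

  shift-⊗ : ∀ {n} (e : Vec ℕ n) (f g : Series n) v → shift e (f ⊗ g) v ≡ (shift e f ⊗ g) v
  shift-⊗ e f g v = trans (maybe0-cong (sub? v e) (λ v' → ⊗≡sumSplits f g v'))
    (trans (sym (sumSplits-shift v e (λ p q → f p * g q)))
     (trans (sumSplits-cong v (λ p q _ → sym (maybe0-* (sub? p e) f (g q)))) (sym (⊗≡sumSplits (shift e f) g v))))

  maybe0-+ : ∀ {A : Set} (r : Maybe A) (f g : A → ℤ) → maybe0 r (λ x → f x + g x) ≡ maybe0 r f + maybe0 r g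
  maybe0-+ nothing f g = refl
  maybe0-+ (just x) f g = refl

  leq-+ : ∀ a b m → leq a m ≡ true → leq (a ℕ.+ b) m ≡ leq b (m ∸ a)
  leq-+ zero b m e = refl
  leq-+ (suc a) b (suc m) e = leq-+ a b m e

  leq-+-false : ∀ a b m → leq a m ≡ false → leq (a ℕ.+ b) m ≡ false
  leq-+-false (suc a) b zero e = refl
  leq-+-false (suc a) b (suc m) e = leq-+-false a b m e

  shift-shift : ∀ {n} (v e e' : Vec ℕ n) (f : Series n) →
    maybe0 (sub? v e) (λ p → maybe0 (sub? p e') f) ≡ maybe0 (sub? v (vadd e e')) f
  shift-shift [] [] [] f = refl
  shift-shift (m ∷ v) (a ∷ e) (b ∷ e') f with leq a m in ea
  ... | false rewrite leq-+-false a b m ea = refl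
  ... | true rewrite leq-+ a b m ea =
    trans (maybe0-consIf (m ∸ a) (sub? v e) (λ p → maybe0 (sub? p (b ∷ e')) f))
     (trans (maybe0-cong (sub? v e) (λ p → cong (λ z → maybe0 (consIf (leq b (m ∸ a)) z (sub? p e')) f) (NP.∸-+-assoc m a b)))
      (aux (leq b (m ∸ a))))
    where
    aux : ∀ c → maybe0 (sub? v e) (λ p → maybe0 (consIf c (m ∸ (a ℕ.+ b)) (sub? p e')) f)
              ≡ maybe0 (consIf c (m ∸ (a ℕ.+ b)) (sub? v (vadd e e'))) f
    aux false = maybe0-zero (sub? v e)
    aux true = trans (maybe0-cong (sub? v e) (λ p → maybe0-consIf (m ∸ (a ℕ.+ b)) (sub? p e') f))
                  (trans (shift-shift v e e' (λ p' → f ((m ∸ (a ℕ.+ b)) ∷ p')))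
                         (sym (maybe0-consIf (m ∸ (a ℕ.+ b)) (sub? v (vadd e e')) f)))

  maybeFalse : ∀ {A : Set} → Maybe A → (A → Bool) → Bool
  maybeFalse nothing f = false
  maybeFalse (just x) f = f x

  ≡ᵇ-∸ : ∀ x e m → leq e m ≡ true → (x ℕ.+ e ≡ᵇ m) ≡ (x ≡ᵇ m ∸ e)
  ≡ᵇ-∸ x zero m t rewrite NP.+-identityʳ x = refl
  ≡ᵇ-∸ x (suc e) (suc m) t rewrite NP.+-suc x e = ≡ᵇ-∸ x e m t

  ≡ᵇ-∸-false : ∀ x e m → leq e m ≡ false → (x ℕ.+ e ≡ᵇ m) ≡ false
  ≡ᵇ-∸-false x (suc e) zero t rewrite NP.+-suc x e = refl
  ≡ᵇ-∸-false x (suc e) (suc m) t rewrite NP.+-suc x e = ≡ᵇ-∸-false x e m t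

  maybeFalse-∧ : ∀ {n} (r : Maybe (Vec ℕ n)) c (g : Vec ℕ n → Bool) → maybeFalse r (λ p → c ∧ g p) ≡ c ∧ maybeFalse r g
  maybeFalse-∧ nothing true g = refl
  maybeFalse-∧ nothing false g = refl
  maybeFalse-∧ (just x) c g = refl

  maybeFalse-consIf : ∀ {n} a (r : Maybe (Vec ℕ n)) (g : Vec ℕ (suc n) → Bool) →
    maybeFalse (consIf true a r) g ≡ maybeFalse r (λ p → g (a ∷ p))
  maybeFalse-consIf a nothing g = refl
  maybeFalse-consIf a (just p) g = refl

  eqV-vadd : ∀ {n} (x e v : Vec ℕ n) → eqV (vadd x e) v ≡ maybeFalse (sub? v e) (eqV x)
  eqV-vadd [] [] [] = refl
  eqV-vadd (x0 ∷ x) (e0 ∷ e) (m ∷ v) with leq e0 m in t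
  ... | true rewrite eqV-vadd x e v | ≡ᵇ-∸ x0 e0 m t =
    sym (trans (maybeFalse-consIf (m ∸ e0) (sub? v e) (eqV (x0 ∷ x))) (maybeFalse-∧ (sub? v e) (x0 ≡ᵇ m ∸ e0) (eqV x)))
  ... | false rewrite ≡ᵇ-∸-false x0 e0 m t = refl

  sub?⇒vadd : ∀ {n} (v e p : Vec ℕ n) → sub? v e ≡ just p → v ≡ vadd p e
  sub?⇒vadd [] [] [] r = refl
  sub?⇒vadd (m ∷ v) (e0 ∷ e) p r with leq e0 m in t | sub? v e in s
  sub?⇒vadd (m ∷ v) (e0 ∷ e) p () | false | _
  sub?⇒vadd (m ∷ v) (e0 ∷ e) p () | true | nothing
  sub?⇒vadd (m ∷ v) (e0 ∷ e) (.(m ∸ e0) ∷ p') refl | true | just p' =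
    cong₂ _∷_ (sym (NP.m∸n+n≡m (NP.≤ᵇ⇒≤ e0 m (subst Data.Bool.T (sym (leb e0 m t)) _)))) (sub?⇒vadd v e p' s)
    where
    import Data.Bool
    leb : ∀ a b → leq a b ≡ true → (a ℕ.≤ᵇ b) ≡ true
    leb zero b t = refl
    leb (suc a) (suc b) t = trans (lb a b) (leb a b t)
      where
      lb : ∀ a b → (suc a ℕ.≤ᵇ suc b) ≡ (a ℕ.≤ᵇ b)
      lb zero b = refl
      lb (suc a) b = refl

  ≡ᵇ-sym : ∀ a b → (a ≡ᵇ b) ≡ (b ≡ᵇ a)
  ≡ᵇ-sym zero zero = refl
  ≡ᵇ-sym zero (suc b) = refl
  ≡ᵇ-sym (suc a) zero = refl
  ≡ᵇ-sym (suc a) (suc b) = ≡ᵇ-sym a b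

  eqV-sym : ∀ {n} (a b : Vec ℕ n) → eqV a b ≡ eqV b a
  eqV-sym [] [] = refl
  eqV-sym (x ∷ a) (y ∷ b) = cong₂ _∧_ (≡ᵇ-sym x y) (eqV-sym a b)

  vadd-comm : ∀ {n} (a b : Vec ℕ n) → vadd a b ≡ vadd b a
  vadd-comm [] [] = refl
  vadd-comm (x ∷ a) (y ∷ b) = cong₂ _∷_ (NP.+-comm x y) (vadd-comm a b)

  indℤ-maybeFalse : ∀ {A : Set} (r : Maybe A) (g : A → Bool) → indℤ (maybeFalse r g) ≡ maybe0 r (λ p → indℤ (g p))
  indℤ-maybeFalse nothing g = refl
  indℤ-maybeFalse (just x) g = refl

  mono-vadd≡shift : ∀ {n} (a b v : Vec ℕ n) → mono (vadd a b) v ≡ shift a (mono b) v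
  mono-vadd≡shift a b v =
    trans (mono≡indℤ (vadd a b) v)
    (trans (cong indℤ (trans (eqV-sym v (vadd a b)) (trans (cong (λ z → eqV z v) (vadd-comm a b)) (eqV-vadd b a v))))
    (trans (indℤ-maybeFalse (sub? v a) (eqV b))
     (maybe0-cong (sub? v a) (λ p → trans (cong indℤ (eqV-sym b p)) (sym (mono≡indℤ b p))))))

module Counting where

  open WordSums
  open BargraphWalks
  open SeriesAlgebra
  open import Data.Nat as ℕ using (ℕ; zero; suc; _∸_; _≡ᵇ_)
  import Data.Nat.Properties as NP
  open import Data.Integer as ℤ using (ℤ; +_)
  open import Data.List using (List; []; _∷_; length)
  open import Data.Vec using (Vec; []; _∷_)
  open import Data.Bool using (Bool; true; false; _∧_; not)
  open import Data.Bool.Properties using (∧-zeroʳ; ∧-identityʳ)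
  open import Data.Maybe using (just; nothing)
  open import Relation.Binary.PropositionalEquality
  open import Relation.Nullary using (¬_)
  open import Data.Nat.Solver using (module +-*-Solver)
  open +-*-Solver using (solve; _:+_; _:*_; _:=_; con)

  -- a bargraph has as many D- as U-steps
  wordLength : Vec ℕ 4 → ℕ
  wordLength (a ∷ b ∷ h ∷ u ∷ []) = h ℕ.+ 2 ℕ.* u

  completes-length : ∀ h p w → completes h p w ≡ true → length w ≡ count isH w ℕ.+ 2 ℕ.* count isU w ℕ.+ h
  completes-length zero p [] e = refl
  completes-length (suc h) p [] ()
  completes-length zero p (s ∷ w) ()
  completes-length (suc h) p (U ∷ w) e rewrite completes-length (suc (suc h)) U w (∧-true-right {compatible p U} e) =
    solve 3 (λ a b c → con 1 :+ (a :+ con 2 :* b :+ (con 2 :+ c)) := a :+ con 2 :* (con 1 :+ b) :+ (con 1 :+ c)) refl (count isH w) (count isU w) h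
  completes-length (suc h) p (H ∷ w) e rewrite completes-length (suc h) H w (∧-true-right {compatible p H} e) =
    solve 3 (λ a b c → con 1 :+ (a :+ con 2 :* b :+ (con 1 :+ c)) := (con 1 :+ a) :+ con 2 :* b :+ (con 1 :+ c)) refl (count isH w) (count isU w) h
  completes-length (suc h) p (D ∷ w) e rewrite completes-length h D w (∧-true-right {compatible p D} e) =
    solve 3 (λ a b c → con 1 :+ (a :+ con 2 :* b :+ c) := a :+ con 2 :* b :+ (con 1 :+ c)) refl (count isH w) (count isU w) h

  isBargraph′-length : ∀ G → isBargraph′ G ≡ true → length G ≡ wordLength (weight G)
  isBargraph′-length [] ()
  isBargraph′-length (H ∷ G) ()
  isBargraph′-length (D ∷ G) ()
  isBargraph′-length (U ∷ w) e rewrite completes-length 1 U w e =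
    solve 2 (λ a b → con 1 :+ (a :+ con 2 :* b :+ con 1) := (con 0 :+ a) :+ con 2 :* (con 1 :+ b)) refl (count isH w) (count isU w)

  #words : (List Step → Bool) → Vec ℕ 4 → ℕ
  #words K p = sumWords (wordLength p) (λ G → ⟦ K G ∧ eqV (weight G) p ⟧)

  ⟦⟧≢0⇒true : ∀ b → ¬ ⟦ b ⟧ ≡ 0 → b ≡ true
  ⟦⟧≢0⇒true true _ = refl
  ⟦⟧≢0⇒true false ne with ne refl
  ... | ()

  wordLength-vadd : ∀ p e → wordLength (vadd p e) ≡ wordLength p ℕ.+ wordLength e
  wordLength-vadd (a ∷ b ∷ h ∷ u ∷ []) (a' ∷ b' ∷ h' ∷ u' ∷ []) =
    solve 4 (λ h h' u u' → (h :+ h') :+ con 2 :* (u :+ u') := (h :+ con 2 :* u) :+ (h' :+ con 2 :* u')) refl h h' u u'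

  shift-#words : ∀ K (e v : Vec ℕ 4) → shift e (λ p → + #words K p) v
    ≡ + sumWords (wordLength v ∸ wordLength e) (λ G → ⟦ K G ∧ eqV (vadd (weight G) e) v ⟧)
  shift-#words K e v with sub? v e in se
  ... | nothing = cong +_ (sym (sumWords-zero (wordLength v ∸ wordLength e) _ (λ G _ →
          cong ⟦_⟧ (trans (cong (K G ∧_) (trans (eqV-vadd (weight G) e v) (cong (λ r → maybeFalse r (eqV (weight G))) se)))
                          (∧-zeroʳ (K G))))))
  ... | just p = cong +_ (trans (cong (λ k → sumWords k (λ G → ⟦ K G ∧ eqV (weight G) p ⟧)) lengthDifference)
                  (sumWords-cong (wordLength v ∸ wordLength e) (λ G _ → cong (λ z → ⟦ K G ∧ z ⟧)
                    (sym (trans (eqV-vadd (weight G) e v) (cong (λ r → maybeFalse r (eqV (weight G))) se))))))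
    where
    lengthDifference : wordLength p ≡ wordLength v ∸ wordLength e
    lengthDifference = sym (begin
      wordLength v ∸ wordLength e           ≡⟨ cong (λ z → wordLength z ∸ wordLength e) (sub?⇒vadd v e p se) ⟩
      wordLength (vadd p e) ∸ wordLength e  ≡⟨ cong (_∸ wordLength e) (wordLength-vadd p e) ⟩
      wordLength p ℕ.+ wordLength e ∸ wordLength e ≡⟨ NP.m+n∸n≡m (wordLength p) (wordLength e) ⟩
      wordLength p ∎)
      where open ≡-Reasoning

  C≐𝓒 : ∀ v → C v ≡ + #words isBargraph′ v
  C≐𝓒 (a ∷ b ∷ h ∷ u ∷ []) = cong +_ (trans (#sat≡sumMap _ (words (h ℕ.+ 2 ℕ.* u)))
    (sumWords-cong (h ℕ.+ 2 ℕ.* u) (λ G _ → cong ⟦_⟧ (cong₂ _∧_ (isBargraph≡isBargraph′ G)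
      (cong (λ z → (#DH G ≡ᵇ a) ∧ ((#UH G ≡ᵇ b) ∧ ((#H G ≡ᵇ h) ∧ z))) (sym (∧-identityʳ (#U G ≡ᵇ u))))))))

  𝓛 𝓜 𝓒 : Series 4
  𝓛 v = + #words isL v
  𝓜 v = + #words isM v
  𝓒 v = + #words isBargraph′ v

  𝓒≐𝓛+𝓜 : ∀ v → 𝓒 v ≡ 𝓛 v ℤ.+ 𝓜 v
  𝓒≐𝓛+𝓜 v = cong +_ (trans
    (sumWords-cong (wordLength v) (λ G _ → split (isBargraph′ G) (endsHD G) (eqV (weight G) v)))
    (sumWords-+ (wordLength v) (λ G → ⟦ isL G ∧ eqV (weight G) v ⟧) (λ G → ⟦ isM G ∧ eqV (weight G) v ⟧)))
    where
    split : ∀ a b c → ⟦ a ∧ c ⟧ ≡ ⟦ (a ∧ b) ∧ c ⟧ ℕ.+ ⟦ (a ∧ not b) ∧ c ⟧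
    split true true c = sym (NP.+-identityʳ _)
    split true false c = refl
    split false b c = refl

module LastColumn where

  open WordSums
  open BargraphWalks
  open SeriesAlgebra
  open Counting
  open import Data.Nat as ℕ using (ℕ; zero; suc; _∸_)
  import Data.Nat.Properties as NP
  open import Data.Integer as ℤ using (ℤ; +_)
  import Data.Integer.Properties as ZP
  open import Data.List using (List; []; _∷_; _++_; length)
  open import Data.List.Properties using (++-assoc)
  open import Data.Vec using ([]; _∷_)
  open import Data.Bool using (Bool; true; false; _∧_)
  open import Data.Bool.Properties using (∧-identityʳ; ∧-comm; ∧-assoc)
  open import Relation.Binary.PropositionalEquality
  open import Relation.Nullary using (¬_)
  open import Data.Empty using (⊥-elim)

  U≢D : ¬ U ≡ D
  U≢D ()
  H≢D : ¬ H ≡ D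
  H≢D ()

  isL-snoc₂ : ∀ w z1 z2 (X : List Step → Bool) → ⟦ isL ((w ++ z1 ∷ []) ++ z2 ∷ []) ∧ X ((w ++ z1 ∷ []) ++ z2 ∷ []) ⟧
     ≡ ⟦ ((z1 =ˢ H) ∧ (z2 =ˢ D)) ∧ (isBargraph′ (w ++ z1 ∷ z2 ∷ []) ∧ X (w ++ z1 ∷ z2 ∷ [])) ⟧
  isL-snoc₂ w z1 z2 X rewrite ++-assoc w (z1 ∷ []) (z2 ∷ []) | endsHD-2 w z1 z2 =
    cong ⟦_⟧ (trans (cong (_∧ X (w ++ z1 ∷ z2 ∷ [])) (∧-comm (isBargraph′ (w ++ z1 ∷ z2 ∷ [])) ((z1 =ˢ H) ∧ (z2 =ˢ D))))
       (∧-assoc ((z1 =ˢ H) ∧ (z2 =ˢ D)) (isBargraph′ (w ++ z1 ∷ z2 ∷ [])) _))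

  sumWords-snocD : ∀ (K : List Step → Bool) → (∀ G → K G ≡ true → isBargraph′ G ≡ true) → ∀ m (X : List Step → Bool) →
    sumWords (suc m) (λ G → ⟦ K G ∧ X G ⟧) ≡ sumWords m (λ w → ⟦ K (w ++ D ∷ []) ∧ X (w ++ D ∷ []) ⟧)
  sumWords-snocD K kb m X = trans (sumWords-snoc m _) (sumWords-cong m (λ w _ →
    trans (cong₂ ℕ._+_ (k0 w U U≢D) (cong₂ ℕ._+_ (k0 w H H≢D) refl)) refl))
    where
    k0 : ∀ w z → ¬ z ≡ D → ⟦ K (w ++ z ∷ []) ∧ X (w ++ z ∷ []) ⟧ ≡ 0
    k0 w z nz = bool-cases (K (w ++ z ∷ []))
      (λ t → ⊥-elim (nz (isBargraph′-snoc⇒D w z (kb _ t))))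
      (λ f → cong (λ b → ⟦ b ∧ X (w ++ z ∷ []) ⟧) f)

  isL⇒isBargraph′ : ∀ G → isL G ≡ true → isBargraph′ G ≡ true
  isL⇒isBargraph′ G t = ∧-true-left {isBargraph′ G} t
  isM⇒isBargraph′ : ∀ G → isM G ≡ true → isBargraph′ G ≡ true
  isM⇒isBargraph′ G t = ∧-true-left {isBargraph′ G} t

  +⟦⟧≡indℤ : ∀ b → + ⟦ b ⟧ ≡ indℤ b
  +⟦⟧≡indℤ true = refl
  +⟦⟧≡indℤ false = refl

  eqV⇒wordLength : ∀ v e → eqV v e ≡ true → wordLength v ≡ wordLength e
  eqV⇒wordLength v e t = cong wordLength (eqV⇒≡ v e t)

  eqV-sxyv-length : ∀ v k → wordLength v ≡ k → ¬ k ≡ 3 → eqV v sxyv ≡ false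
  eqV-sxyv-length v k ln nk =
    bool-cases (eqV v sxyv) (λ t → ⊥-elim (nk (trans (sym ln) (eqV⇒wordLength v sxyv t)))) (λ e → e)

  sumWords-isL : ∀ m (X : List Step → Bool) → sumWords (suc (suc m)) (λ G → ⟦ isL G ∧ X G ⟧)
    ≡ sumWords m (λ w → ⟦ isL (w ++ H ∷ D ∷ []) ∧ X (w ++ H ∷ D ∷ []) ⟧)
  sumWords-isL m X =
    trans (sumWords-snoc (suc m) f) (trans (sumWords-snoc m lastStepSum) (sumWords-cong m (λ w _ → lastTwoSteps w)))
    where
    f : List Step → ℕ
    f G = ⟦ isL G ∧ X G ⟧
    lastStepSum : List Step → ℕ
    lastStepSum w = f (w ++ U ∷ []) ℕ.+ (f (w ++ H ∷ []) ℕ.+ f (w ++ D ∷ []))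
    isL-HD : ∀ w → isL (w ++ H ∷ D ∷ []) ≡ isBargraph′ (w ++ H ∷ D ∷ [])
    isL-HD w rewrite endsHD-2 w H D = ∧-identityʳ _
    lastTwoSteps : ∀ w → lastStepSum (w ++ U ∷ []) ℕ.+ (lastStepSum (w ++ H ∷ []) ℕ.+ lastStepSum (w ++ D ∷ []))
                         ≡ f (w ++ H ∷ D ∷ [])
    lastTwoSteps w
      rewrite isL-snoc₂ w U U X | isL-snoc₂ w U H X | isL-snoc₂ w U D X
            | isL-snoc₂ w H U X | isL-snoc₂ w H H X | isL-snoc₂ w H D X
            | isL-snoc₂ w D U X | isL-snoc₂ w D H X | isL-snoc₂ w D D X | isL-HD w = NP.+-identityʳ _

  sumWords-isSingleU : ∀ v m → wordLength v ≡ suc (suc m) →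
    sumWords m (λ w → ⟦ isSingleU w ∧ eqV (weight (w ++ H ∷ D ∷ [])) v ⟧) ≡ ⟦ eqV v sxyv ⟧
  sumWords-isSingleU v zero ln rewrite eqV-sxyv-length v 2 ln (λ ()) = refl
  sumWords-isSingleU v (suc zero) ln = trans (NP.+-identityʳ _) (cong ⟦_⟧ (eqV-sym (0 ∷ 1 ∷ 1 ∷ 1 ∷ []) v))
  sumWords-isSingleU v (suc (suc m)) ln
    rewrite eqV-sxyv-length v (suc (suc (suc (suc m)))) ln (λ ()) = sumWords-zero (suc (suc m)) _ longWord
    where
    longWord : ∀ w → length w ≡ suc (suc m) → ⟦ isSingleU w ∧ eqV (weight (w ++ H ∷ D ∷ [])) v ⟧ ≡ 0
    longWord (U ∷ x ∷ w) l = refl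
    longWord (H ∷ w) l = refl
    longWord (D ∷ w) l = refl

  𝓛-lastColumn : ∀ v → 𝓛 v ≡ (mono sxyv v ℤ.+ shift xv 𝓛 v) ℤ.+ shift txv 𝓜 v
  𝓛-lastColumn v =
    trans (cong +_ (byLength (wordLength v) refl))
      (sym (trans (ZP.+-assoc (mono sxyv v) _ _)
        (cong₂ ℤ._+_ (trans (mono≡indℤ sxyv v) (sym (+⟦⟧≡indℤ (eqV v sxyv))))
                     (cong₂ ℤ._+_ (shift-#words isL xv v) (shift-#words isM txv v)))))
    where
    byLength : ∀ k → wordLength v ≡ k → sumWords k (λ G → ⟦ isL G ∧ eqV (weight G) v ⟧)
      ≡ ⟦ eqV v sxyv ⟧ ℕ.+ (sumWords (k ∸ 1) (λ G → ⟦ isL G ∧ eqV (vadd (weight G) xv) v ⟧)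
                         ℕ.+ sumWords (k ∸ 1) (λ G → ⟦ isM G ∧ eqV (vadd (weight G) txv) v ⟧))
    byLength zero ln rewrite eqV-sxyv-length v 0 ln (λ ()) = refl
    byLength (suc zero) ln rewrite eqV-sxyv-length v 1 ln (λ ()) = refl
    byLength (suc (suc m)) ln =
      trans (sumWords-isL m (λ G → eqV (weight G) v))
        (trans (sumWords-cong m (λ w _ → isL-lastColumn w v))
          (trans (sumWords-+ m _ _) (cong₂ ℕ._+_ (sumWords-isSingleU v m ln)
            (trans (sumWords-+ m _ _)
              (sym (cong₂ ℕ._+_ (sumWords-snocD isL isL⇒isBargraph′ m (λ G → eqV (vadd (weight G) xv) v))
                                (sumWords-snocD isM isM⇒isBargraph′ m (λ G → eqV (vadd (weight G) txv) v))))))))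

module FirstColumn where

  open WordSums
  open BargraphWalks
  open SeriesAlgebra
  open Counting
  open LastColumn using (sumWords-snocD; isL⇒isBargraph′; +⟦⟧≡indℤ)
  open import Data.Nat as ℕ using (ℕ; zero; suc; _∸_; _≡ᵇ_)
  import Data.Nat.Properties as NP
  open import Data.Integer as ℤ using (ℤ; +_)
  import Data.Integer.Properties as ZP
  open import Data.List using (List; []; _∷_; _++_; length)
  open import Data.List.Properties using (length-++)
  open import Data.Vec using (Vec; []; _∷_)
  open import Data.Product using (proj₁; proj₂)
  open import Data.Maybe using (Maybe; just; nothing)
  open import Data.Bool using (Bool; true; false; if_then_else_; _∧_)
  open import Relation.Binary.PropositionalEquality
  open import Relation.Nullary using (¬_)
  open import Data.Empty using (⊥-elim)
  open import Data.Nat.Solver using (module +-*-Solver)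
  open import Function using (_∘_)

  ⟦∧⟧≡* : ∀ a b → ⟦ a ∧ b ⟧ ≡ ⟦ a ⟧ ℕ.* ⟦ b ⟧
  ⟦∧⟧≡* true b = sym (NP.+-identityʳ _)
  ⟦∧⟧≡* false b = refl

  sumSplitsℕ : ∀ {n} → Vec ℕ n → (Vec ℕ n → Vec ℕ n → ℕ) → ℕ
  sumSplitsℕ v F = sumMap (splits v) (λ pq → F (proj₁ pq) (proj₂ pq))

  sumSplitsℕ-cong : ∀ {n} (v : Vec ℕ n) {F G : Vec ℕ n → Vec ℕ n → ℕ} →
    (∀ p q → vadd p q ≡ v → F p q ≡ G p q) → sumSplitsℕ v F ≡ sumSplitsℕ v G
  sumSplitsℕ-cong v {F} {G} h = ZP.+-injective
    (trans (sym (sumSplits-pos v F)) (trans (sumSplits-cong v (λ p q e → cong +_ (h p q e))) (sumSplits-pos v G)))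

  eqV-vadd′ : ∀ {n} (a b v : Vec ℕ n) → eqV v (vadd a b) ≡ maybeFalse (sub? v a) (λ p → eqV p b)
  eqV-vadd′ a b v = trans (eqV-sym v (vadd a b)) (trans (cong (λ z → eqV z v) (vadd-comm a b))
    (trans (eqV-vadd b a v) (mbB-cong (sub? v a))))
    where
    mbB-cong : ∀ (r : Maybe _) → maybeFalse r (eqV b) ≡ maybeFalse r (λ p → eqV p b)
    mbB-cong nothing = refl
    mbB-cong (just p) = eqV-sym b p

  sumSplitsℕ-indicator : ∀ {n} (a b v : Vec ℕ n) →
    sumSplitsℕ v (λ p q → ⟦ eqV a p ⟧ ℕ.* ⟦ eqV b q ⟧) ≡ ⟦ eqV (vadd a b) v ⟧
  sumSplitsℕ-indicator a b v = ZP.+-injective (begin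
      + sumSplitsℕ v (λ p q → ⟦ eqV a p ⟧ ℕ.* ⟦ eqV b q ⟧)
    ≡⟨ sym (sumSplits-pos v _) ⟩
      sumSplits v (λ p q → + (⟦ eqV a p ⟧ ℕ.* ⟦ eqV b q ⟧))
    ≡⟨ sumSplits-cong v (λ p q _ → trans (ZP.pos-* ⟦ eqV a p ⟧ ⟦ eqV b q ⟧) (cong₂ ℤ._*_ (ind a p) (ind b q))) ⟩
      sumSplits v (λ p q → indℤ (eqV p a) ℤ.* indℤ (eqV q b))
    ≡⟨ sumSplits-indicator v a (λ q → indℤ (eqV q b)) ⟩
      maybe0 (sub? v a) (λ q → indℤ (eqV q b))
    ≡⟨ sym (indℤ-maybeFalse (sub? v a) (λ q → eqV q b)) ⟩
      indℤ (maybeFalse (sub? v a) (λ q → eqV q b))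
    ≡⟨ cong indℤ (trans (sym (eqV-vadd′ a b v)) (eqV-sym v (vadd a b))) ⟩
      indℤ (eqV (vadd a b) v)
    ≡⟨ sym (+⟦⟧≡indℤ (eqV (vadd a b) v)) ⟩
      + ⟦ eqV (vadd a b) v ⟧
    ∎)
    where
    open ≡-Reasoning
    ind : ∀ {n} (a p : Vec ℕ n) → + ⟦ eqV a p ⟧ ≡ indℤ (eqV p a)
    ind a p = trans (+⟦⟧≡indℤ (eqV a p)) (cong indℤ (eqV-sym a p))

  weight-glue′ : ∀ x B → isL (x ++ D ∷ []) ≡ true → isBargraph′ B ≡ true →
    weight (x ++ (B ++ D ∷ [])) ≡ vadd (weight (x ++ D ∷ [])) (weight B)
  weight-glue′ [] B () b
  weight-glue′ (H ∷ x) B () b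
  weight-glue′ (D ∷ x) B () b
  weight-glue′ (U ∷ x') [] l ()
  weight-glue′ (U ∷ x') (H ∷ B) l ()
  weight-glue′ (U ∷ x') (D ∷ B) l ()
  weight-glue′ (U ∷ x') (U ∷ B') l b = weight-glue x' B'

  headOfWeight : Vec ℕ 4 → List Step → ℕ
  headOfWeight p x = ⟦ isL (x ++ D ∷ []) ∧ eqV (weight (x ++ D ∷ [])) p ⟧

  tailOfWeight : Vec ℕ 4 → List Step → ℕ
  tailOfWeight q y = ⟦ isBargraphThenD y ∧ eqV (weight (dropLast y)) q ⟧

  gluedAt-split : ∀ v x y → gluedAt x y ℕ.* ⟦ eqV (weight (x ++ y)) v ⟧
    ≡ sumSplitsℕ v (λ p q → headOfWeight p x ℕ.* tailOfWeight q y)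
  gluedAt-split v x y = sym (
    trans (sumSplitsℕ-cong v (λ p q _ → rearrange (isL xD) (isBargraphThenD y) (eqV (weight xD) p) (eqV (weight tailB) q)))
      (trans (sumMap-* (splits v) ⟦ isL xD ∧ isBargraphThenD y ⟧
                (λ pq → ⟦ eqV (weight xD) (proj₁ pq) ⟧ ℕ.* ⟦ eqV (weight tailB) (proj₂ pq) ⟧))
        (trans (cong (gluedAt x y ℕ.*_) (sumSplitsℕ-indicator (weight xD) (weight tailB) v))
          (byCases (isL xD) (isBargraphThenD y) refl refl))))
    where
    xD tailB : List Step
    xD = x ++ D ∷ []
    tailB = dropLast y
    rearrange : ∀ a r c d → ⟦ a ∧ c ⟧ ℕ.* ⟦ r ∧ d ⟧ ≡ ⟦ a ∧ r ⟧ ℕ.* (⟦ c ⟧ ℕ.* ⟦ d ⟧)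
    rearrange true true c d = sym (NP.+-identityʳ (⟦ c ⟧ ℕ.* ⟦ d ⟧))
    rearrange true false c d = NP.*-zeroʳ ⟦ c ⟧
    rearrange false r c d = refl
    byCases : ∀ a r → isL xD ≡ a → isBargraphThenD y ≡ r →
      ⟦ a ∧ r ⟧ ℕ.* ⟦ eqV (vadd (weight xD) (weight tailB)) v ⟧ ≡ gluedAt x y ℕ.* ⟦ eqV (weight (x ++ y)) v ⟧
    byCases true true ea er rewrite ea | er =
      cong (λ z → ⟦ eqV z v ⟧ ℕ.+ 0)
        (sym (trans (cong (λ z → weight (x ++ z)) (lastIsD⇒dropLast-++ y (∧-true-left {lastIsD y} er)))
                    (weight-glue′ x tailB ea (∧-true-right {lastIsD y} er))))
    byCases true false ea er rewrite ea | er = refl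
    byCases false r ea er rewrite ea = refl

  isBargraphThenD-snoc : ∀ B z → isBargraphThenD (B ++ z ∷ []) ≡ (z =ˢ D) ∧ isBargraph′ B
  isBargraphThenD-snoc B z rewrite lastIsD-snoc B z | dropLast-snoc B z = refl

  sumWords-isRaised : ∀ v k → sumWords k (λ G → isRaised G ℕ.* ⟦ eqV (weight G) v ⟧)
    ≡ sumWords (k ∸ 2) (λ B → ⟦ isBargraph′ B ∧ eqV (vadd (weight B) yv) v ⟧)
  sumWords-isRaised v zero = refl
  sumWords-isRaised v (suc zero) = refl
  sumWords-isRaised v (suc (suc m)) =
    trans (sumWords-suc (suc m) _) (trans (sumWords-cong (suc m) (λ w _ → NP.+-identityʳ _))
      (trans (sumWords-snoc m _) (sumWords-cong m (λ B _ → finalStep B))))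
    where
    raised : List Step → ℕ
    raised w = ⟦ isBargraphThenD w ⟧ ℕ.* ⟦ eqV (weight (U ∷ w)) v ⟧
    raise : ∀ B → ⟦ isBargraph′ B ⟧ ℕ.* ⟦ eqV (weight (U ∷ B ++ D ∷ [])) v ⟧
                ≡ ⟦ isBargraph′ B ∧ eqV (vadd (weight B) yv) v ⟧
    raise [] = refl
    raise (H ∷ B) = refl
    raise (D ∷ B) = refl
    raise (U ∷ B') rewrite weight-raise B' = sym (⟦∧⟧≡* (completes 1 U B') _)
    finalStep : ∀ B → raised (B ++ U ∷ []) ℕ.+ (raised (B ++ H ∷ []) ℕ.+ raised (B ++ D ∷ []))
                   ≡ ⟦ isBargraph′ B ∧ eqV (vadd (weight B) yv) v ⟧
    finalStep B
      rewrite isBargraphThenD-snoc B U | isBargraphThenD-snoc B H | isBargraphThenD-snoc B D = raise B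

  isL-D⇒length : ∀ p x → (isL (x ++ D ∷ []) ∧ eqV (weight (x ++ D ∷ [])) p) ≡ true → suc (length x) ≡ wordLength p
  isL-D⇒length p x t = begin
    suc (length x)            ≡⟨ NP.+-comm 1 (length x) ⟩
    length x ℕ.+ 1            ≡⟨ sym (length-++ x) ⟩
    length (x ++ D ∷ [])      ≡⟨ isBargraph′-length (x ++ D ∷ []) (isL⇒isBargraph′ (x ++ D ∷ []) (∧-true-left {isL (x ++ D ∷ [])} t)) ⟩
    wordLength (weight (x ++ D ∷ [])) ≡⟨ cong wordLength (eqV⇒≡ _ p (∧-true-right {isL (x ++ D ∷ [])} t)) ⟩
    wordLength p              ∎
    where open ≡-Reasoning

  sumWords-headOfWeight : ∀ k p → sumWords k (headOfWeight p) ≡ (if suc k ≡ᵇ wordLength p then #words isL p else 0)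
  sumWords-headOfWeight k p with wordLength p in lp
  ... | zero = sumWords-zero k (headOfWeight p) (λ x _ →
          bool-cases (isL (x ++ D ∷ []) ∧ eqV (weight (x ++ D ∷ [])) p)
            (λ t → ⊥-elim (NP.1+n≢0 (trans (isL-D⇒length p x t) lp)))
            (cong ⟦_⟧))
  ... | suc l = trans (sumWords-support k l (headOfWeight p)
                        (λ x ne → NP.suc-injective (trans (isL-D⇒length p x (⟦⟧≢0⇒true _ ne)) lp)))
          (cong (λ z → if k ≡ᵇ l then z else 0) (sym (sumWords-snocD isL isL⇒isBargraph′ l (λ G → eqV (weight G) p))))

  sumWords-tailOfWeight : ∀ m q → sumWords m (tailOfWeight q)
    ≡ (if m ≡ᵇ suc (wordLength q) then #words isBargraph′ q else 0)
  sumWords-tailOfWeight m q =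
    trans (sumWords-support m (suc (wordLength q)) (tailOfWeight q) tailLength)
      (cong (λ z → if m ≡ᵇ suc (wordLength q) then z else 0)
        (trans (sumWords-snoc (wordLength q) (tailOfWeight q)) (sumWords-cong (wordLength q) (λ B _ → finalStep B))))
    where
    tailLength : ∀ y → ¬ tailOfWeight q y ≡ 0 → length y ≡ suc (wordLength q)
    tailLength y ne = begin
      length y                        ≡⟨ cong length (lastIsD⇒dropLast-++ y (∧-true-left {lastIsD y} yBD)) ⟩
      length (dropLast y ++ D ∷ [])   ≡⟨ trans (length-++ (dropLast y)) (NP.+-comm _ 1) ⟩
      suc (length (dropLast y))       ≡⟨ cong suc (isBargraph′-length (dropLast y) (∧-true-right {lastIsD y} yBD)) ⟩
      suc (wordLength (weight (dropLast y))) ≡⟨ cong (suc ∘ wordLength) (eqV⇒≡ _ q (∧-true-right {isBargraphThenD y} t)) ⟩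
      suc (wordLength q)              ∎
      where
      open ≡-Reasoning
      t = ⟦⟧≢0⇒true _ ne
      yBD = ∧-true-left {isBargraphThenD y} t
    finalStep : ∀ B → tailOfWeight q (B ++ U ∷ []) ℕ.+ (tailOfWeight q (B ++ H ∷ []) ℕ.+ tailOfWeight q (B ++ D ∷ []))
                   ≡ ⟦ isBargraph′ B ∧ eqV (weight B) q ⟧
    finalStep B = cong₂ ℕ._+_ (cong ⟦_⟧ (snoc U)) (cong₂ ℕ._+_ (cong ⟦_⟧ (snoc H)) (cong ⟦_⟧ (snoc D)))
      where
      snoc : ∀ z → isBargraphThenD (B ++ z ∷ []) ∧ eqV (weight (dropLast (B ++ z ∷ []))) q
                   ≡ ((z =ˢ D) ∧ isBargraph′ B) ∧ eqV (weight B) q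
      snoc z rewrite isBargraphThenD-snoc B z | dropLast-snoc B z = refl

  sumWords-sumSplitsℕ : ∀ v k m →
    sumWords k (λ x → sumWords m (λ y → sumSplitsℕ v (λ p q → headOfWeight p x ℕ.* tailOfWeight q y)))
    ≡ sumSplitsℕ v (λ p q → sumWords k (headOfWeight p) ℕ.* sumWords m (tailOfWeight q))
  sumWords-sumSplitsℕ v k m =
    trans (sumWords-cong k (λ x _ → trans (sumMap-swap (words m) (splits v) (λ y pq → head pq x ℕ.* tail pq y))
                                          (sumMap-cong (splits v) (λ pq → sumWords-* m (head pq x) (tail pq)))))
      (trans (sumMap-swap (words k) (splits v) (λ x pq → head pq x ℕ.* sumWords m (tail pq)))
        (sumMap-cong (splits v) (λ pq →
          trans (sumWords-cong k (λ x _ → NP.*-comm (head pq x) (sumWords m (tail pq))))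
            (trans (sumWords-* k (sumWords m (tail pq)) (head pq)) (NP.*-comm (sumWords m (tail pq)) (sumWords k (head pq)))))))
    where
    head tail : Vec ℕ 4 × Vec ℕ 4 → List Step → ℕ
    head pq = headOfWeight (proj₁ pq)
    tail pq = tailOfWeight (proj₂ pq)

  sumPairs-head*tail : ∀ v p q → vadd p q ≡ v →
    sumPairs (wordLength v) (λ k m → sumWords k (headOfWeight p) ℕ.* sumWords m (tailOfWeight q))
    ≡ #words isL p ℕ.* #words isBargraph′ q
  sumPairs-head*tail v p q pqv =
    trans (sumPairs-cong (wordLength v) (λ k m _ → cong₂ ℕ._*_ (sumWords-headOfWeight k p) (sumWords-tailOfWeight m q)))
          (byLength (wordLength p) refl)
    where
    byLength : ∀ lp → wordLength p ≡ lp →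
      sumPairs (wordLength v) (λ k m → (if suc k ≡ᵇ wordLength p then #words isL p else 0)
                                      ℕ.* (if m ≡ᵇ suc (wordLength q) then #words isBargraph′ q else 0))
      ≡ #words isL p ℕ.* #words isBargraph′ q
    byLength zero e rewrite e = sumPairs-zero (wordLength v) _ (λ k m → refl)
    byLength (suc l) e rewrite e = sumPairs-indicator (wordLength v) l (suc (wordLength q)) _ _
      (trans (NP.+-suc l (wordLength q))
        (sym (trans (cong wordLength (sym pqv)) (trans (wordLength-vadd p q) (cong (ℕ._+ wordLength q) e)))))

  sumWords-gluedAt : ∀ v → sumWords (wordLength v) (λ G → sumCuts gluedAt G ℕ.* ⟦ eqV (weight G) v ⟧)
    ≡ sumSplitsℕ v (λ p q → #words isL p ℕ.* #words isBargraph′ q)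
  sumWords-gluedAt v =
    begin
      sumWords n (λ G → sumCuts gluedAt G ℕ.* ⟦ eqV (weight G) v ⟧)
    ≡⟨ sumWords-cong n (λ G _ → sumCuts-* gluedAt (λ G → ⟦ eqV (weight G) v ⟧) G) ⟩
      sumWords n (sumCuts (λ x y → gluedAt x y ℕ.* ⟦ eqV (weight (x ++ y)) v ⟧))
    ≡⟨ sumWords-sumCuts n _ ⟩
      sumPairs n (λ k m → sumWords k (λ x → sumWords m (λ y → gluedAt x y ℕ.* ⟦ eqV (weight (x ++ y)) v ⟧)))
    ≡⟨ sumPairs-cong n (λ k m _ → trans (sumWords-cong k (λ x _ → sumWords-cong m (λ y _ → gluedAt-split v x y)))
                                        (sumWords-sumSplitsℕ v k m)) ⟩
      sumPairs n (λ k m → sumSplitsℕ v (λ p q → sumWords k (headOfWeight p) ℕ.* sumWords m (tailOfWeight q)))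
    ≡⟨ sumPairs-sumMap n (splits v) _ ⟩
      sumSplitsℕ v (λ p q → sumPairs n (λ k m → sumWords k (headOfWeight p) ℕ.* sumWords m (tailOfWeight q)))
    ≡⟨ sumSplitsℕ-cong v (sumPairs-head*tail v) ⟩
      sumSplitsℕ v (λ p q → #words isL p ℕ.* #words isBargraph′ q)
    ∎
    where
    open ≡-Reasoning
    n = wordLength v

  #words-firstColumn : ∀ v → #words isBargraph′ v
    ≡ (sumWords (wordLength v) (λ G → isRaised G ℕ.* ⟦ eqV (weight G) v ⟧) ℕ.+ #words isL v)
      ℕ.+ sumWords (wordLength v) (λ G → sumCuts gluedAt G ℕ.* ⟦ eqV (weight G) v ⟧)
  #words-firstColumn v =
    trans (sumWords-cong n (λ G _ → perWord G))
          (trans (sumWords-+ n _ _) (cong (ℕ._+ sumWords n (λ G → sumCuts gluedAt G ℕ.* ⟦ X G ⟧)) (sumWords-+ n _ _)))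
    where
    n = wordLength v
    X : List Step → Bool
    X G = eqV (weight G) v
    perWord : ∀ G → ⟦ isBargraph′ G ∧ X G ⟧
      ≡ (isRaised G ℕ.* ⟦ X G ⟧ ℕ.+ ⟦ isL G ∧ X G ⟧) ℕ.+ sumCuts gluedAt G ℕ.* ⟦ X G ⟧
    perWord G
      rewrite ⟦∧⟧≡* (isBargraph′ G) (X G) | isBargraph′-firstColumn G | ⟦∧⟧≡* (isL G) (X G) =
        solve 4 (λ r l c x → (r :+ (l :+ c)) :* x := (r :* x :+ l :* x) :+ c :* x) refl
          (isRaised G) ⟦ isL G ⟧ (sumCuts gluedAt G) ⟦ X G ⟧
      where open +-*-Solver using (solve; _:+_; _:*_; _:=_)

  𝓒-firstColumn : ∀ v → 𝓒 v ≡ (shift yv 𝓒 v ℤ.+ 𝓛 v) ℤ.+ (𝓛 ⊗ 𝓒) v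
  𝓒-firstColumn v =
    trans (cong +_ (#words-firstColumn v))
      (cong₂ ℤ._+_ (cong (ℤ._+ 𝓛 v) raised) (sym glued))
    where
    raised : + sumWords (wordLength v) (λ G → isRaised G ℕ.* ⟦ eqV (weight G) v ⟧) ≡ shift yv 𝓒 v
    raised = trans (cong +_ (sumWords-isRaised v (wordLength v))) (sym (shift-#words isBargraph′ yv v))
    glued : (𝓛 ⊗ 𝓒) v ≡ + sumWords (wordLength v) (λ G → sumCuts gluedAt G ℕ.* ⟦ eqV (weight G) v ⟧)
    glued = trans (⊗≡sumSplits 𝓛 𝓒 v)
      (trans (sumSplits-cong v (λ p q _ → sym (ZP.pos-* (#words isL p) (#words isBargraph′ q))))
        (trans (sumSplits-pos v (λ p q → #words isL p ℕ.* #words isBargraph′ q)) (cong +_ (sym (sumWords-gluedAt v)))))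

module FunctionalEquation where

  open BargraphWalks using (vadd; yv; xv; txv; sxyv)
  open SeriesAlgebra
  open Counting
  open LastColumn using (𝓛-lastColumn)
  open FirstColumn using (𝓒-firstColumn)
  open import Data.Nat as ℕ using (ℕ)
  open import Data.Integer as ℤ using (ℤ; +_; 0ℤ; _+_; _-_; -_)
  import Data.Integer.Properties as ZP
  open import Data.Vec using (Vec; []; _∷_)
  open import Relation.Binary.PropositionalEquality
  open import Data.Integer.Solver using (module +-*-Solver)
  open +-*-Solver using (solve; _:+_; _:-_; :-_; _:=_)

  tv sv xyv txyv : Vec ℕ 4
  tv = 1 ∷ 0 ∷ 0 ∷ 0 ∷ []
  sv = 0 ∷ 1 ∷ 0 ∷ 0 ∷ []
  xyv = 0 ∷ 0 ∷ 1 ∷ 1 ∷ []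
  txyv = 1 ∷ 0 ∷ 1 ∷ 1 ∷ []

  ⊗-congʳ : ∀ {n} (f : Series n) {g g' : Series n} v → (∀ p → g p ≡ g' p) → (f ⊗ g) v ≡ (f ⊗ g') v
  ⊗-congʳ f {g} {g'} v e =
    trans (⊗≡sumSplits f g v) (trans (sumSplits-cong v (λ p q _ → cong (f p ℤ.*_) (e q))) (sym (⊗≡sumSplits f g' v)))

  mono⊗mono⊗ : ∀ {n} (a b : Vec ℕ n) (f : Series n) v → ((mono a ⊗ mono b) ⊗ f) v ≡ shift (vadd a b) f v
  mono⊗mono⊗ a b f v = trans (⊗-congˡ f v (mono⊗≡shift a (mono b)))
    (trans (sym (shift-⊗ a (mono b) f v))
      (trans (maybe0-cong (sub? v a) (λ p → mono⊗≡shift b f p)) (shift-shift v a b f)))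

  mono⊗mono⊗mono⊗ : ∀ {n} (a b c : Vec ℕ n) (f : Series n) v →
    (((mono a ⊗ mono b) ⊗ mono c) ⊗ f) v ≡ shift (vadd (vadd a b) c) f v
  mono⊗mono⊗mono⊗ a b c f v = trans (⊗-congˡ f v (mono⊗mono⊗ a b (mono c)))
    (trans (sym (shift-⊗ (vadd a b) (mono c) f v))
      (trans (maybe0-cong (sub? v (vadd a b)) (λ p → mono⊗≡shift c f p)) (shift-shift v (vadd a b) c f)))

  mono⊗mono⊗mono : ∀ {n} (a b c : Vec ℕ n) v → ((mono a ⊗ mono b) ⊗ mono c) v ≡ mono (vadd (vadd a b) c) v
  mono⊗mono⊗mono a b c v = trans (mono⊗mono⊗ a b (mono c) v) (sym (mono-vadd≡shift (vadd a b) c v))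

  -- Eliminates L and M from the coefficient identities of C = yC + L + LC at v, v − x and
  -- v − tx, of L = sxy + xL + txM, and of C = L + M at v − tx.
  functionalEquation-algebra : ∀ (c cx cy cxy ctx ctxy csxy one K l LC lx LxC ltx LtxC mtx MtxC : ℤ) →
    c ≡ (cy + l) + LC → cx ≡ (cxy + lx) + LxC → ctx ≡ (ctxy + ltx) + LtxC →
    l ≡ (one + lx) + mtx → LC ≡ (csxy + LxC) + MtxC → K ≡ LtxC + MtxC → ctx ≡ ltx + mtx →
    (K - (((((c - cx) - cy) + cxy) - ctxy) - csxy)) + one ≡ 0ℤ
  functionalEquation-algebra
    .((cy + ((one + lx) + mtx)) + ((csxy + LxC) + MtxC)) .((cxy + lx) + LxC) cy cxy .(ltx + mtx) ctxy csxy
    one .(LtxC + MtxC) .((one + lx) + mtx) .((csxy + LxC) + MtxC) lx LxC ltx LtxC mtx MtxC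
    refl refl ctx≡ refl refl refl refl =
    trans (solve 11 (λ cy cxy ctxy csxy one lx LxC ltx LtxC mtx MtxC →
             ((LtxC :+ MtxC) :- (((((((cy :+ ((one :+ lx) :+ mtx)) :+ ((csxy :+ LxC) :+ MtxC))
               :- ((cxy :+ lx) :+ LxC)) :- cy) :+ cxy) :- ctxy) :- csxy)) :+ one
             := ((ctxy :+ ltx) :+ LtxC) :- (ltx :+ mtx))
             refl cy cxy ctxy csxy one lx LxC ltx LtxC mtx MtxC)
      (trans (cong (λ z → z - (ltx + mtx)) (sym ctx≡)) (ZP.+-inverseʳ (ltx + mtx)))

  shift-C : ∀ e v → shift e C v ≡ shift e 𝓒 v
  shift-C e v = maybe0-cong (sub? v e) C≐𝓒

  shift-𝓒-firstColumn : ∀ e v →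
    shift e 𝓒 v ≡ (shift (vadd e yv) 𝓒 v + shift e 𝓛 v) + (shift e 𝓛 ⊗ 𝓒) v
  shift-𝓒-firstColumn e v = trans (maybe0-cong (sub? v e) 𝓒-firstColumn)
    (trans (maybe0-+ (sub? v e) _ _)
      (cong₂ _+_ (trans (maybe0-+ (sub? v e) _ _) (cong₂ _+_ (shift-shift v e yv 𝓒) refl)) (shift-⊗ e 𝓛 𝓒 v)))

  shift-𝓒≐𝓛+𝓜 : ∀ e v → shift e 𝓒 v ≡ shift e 𝓛 v + shift e 𝓜 v
  shift-𝓒≐𝓛+𝓜 e v = trans (maybe0-cong (sub? v e) 𝓒≐𝓛+𝓜) (maybe0-+ (sub? v e) _ _)

  linearPart : Vec ℕ 4 → ℤ
  linearPart v = ((((𝓒 v - shift xv 𝓒 v) - shift yv 𝓒 v) + shift xyv 𝓒 v) - shift txyv 𝓒 v) - shift sxyv 𝓒 v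

  functionalEquation-coeff : ∀ v → ((shift txv 𝓒 ⊗ 𝓒) v - linearPart v) + mono sxyv v ≡ 0ℤ
  functionalEquation-coeff v =
    functionalEquation-algebra
      (𝓒 v) (shift xv 𝓒 v) (shift yv 𝓒 v) (shift xyv 𝓒 v) (shift txv 𝓒 v) (shift txyv 𝓒 v) (shift sxyv 𝓒 v)
      (mono sxyv v) ((shift txv 𝓒 ⊗ 𝓒) v) (𝓛 v) ((𝓛 ⊗ 𝓒) v) (shift xv 𝓛 v) ((shift xv 𝓛 ⊗ 𝓒) v)
      (shift txv 𝓛 v) ((shift txv 𝓛 ⊗ 𝓒) v) (shift txv 𝓜 v) ((shift txv 𝓜 ⊗ 𝓒) v)
      (𝓒-firstColumn v) (shift-𝓒-firstColumn xv v) (shift-𝓒-firstColumn txv v) (𝓛-lastColumn v)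
      𝓛⊗𝓒 tx𝓒⊗𝓒 (shift-𝓒≐𝓛+𝓜 txv v)
    where
    𝓛⊗𝓒 : (𝓛 ⊗ 𝓒) v ≡ (shift sxyv 𝓒 v + (shift xv 𝓛 ⊗ 𝓒) v) + (shift txv 𝓜 ⊗ 𝓒) v
    𝓛⊗𝓒 = trans (⊗-congˡ 𝓒 v 𝓛-lastColumn)
      (trans (⊗-distribʳ-⊕ (λ p → mono sxyv p + shift xv 𝓛 p) (shift txv 𝓜) 𝓒 v)
        (cong (_+ (shift txv 𝓜 ⊗ 𝓒) v)
          (trans (⊗-distribʳ-⊕ (mono sxyv) (shift xv 𝓛) 𝓒 v) (cong (_+ (shift xv 𝓛 ⊗ 𝓒) v) (mono⊗≡shift sxyv 𝓒 v)))))
    tx𝓒⊗𝓒 : (shift txv 𝓒 ⊗ 𝓒) v ≡ (shift txv 𝓛 ⊗ 𝓒) v + (shift txv 𝓜 ⊗ 𝓒) v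
    tx𝓒⊗𝓒 = trans (⊗-congˡ 𝓒 v (shift-𝓒≐𝓛+𝓜 txv)) (⊗-distribʳ-⊕ (shift txv 𝓛) (shift txv 𝓜) 𝓒 v)

  functionalEquation : (tᶜ ⊗ xᶜ ⊗ C ⊗ C
        ⊖ (𝟙 ⊖ xᶜ ⊖ yᶜ ⊕ xᶜ ⊗ yᶜ ⊖ tᶜ ⊗ xᶜ ⊗ yᶜ ⊖ sᶜ ⊗ xᶜ ⊗ yᶜ) ⊗ C
        ⊕ sᶜ ⊗ xᶜ ⊗ yᶜ) ≐ 𝟘
  functionalEquation v =
    trans (cong₂ (λ a b → (a - b) + ((sᶜ ⊗ xᶜ) ⊗ yᶜ) v) quadratic linear)
      (trans (cong (λ z → ((shift txv 𝓒 ⊗ 𝓒) v - linearPart v) + z) (mono⊗mono⊗mono sv xv yv v)) (functionalEquation-coeff v))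
    where
    quadratic : (tᶜ ⊗ xᶜ ⊗ C ⊗ C) v ≡ (shift txv 𝓒 ⊗ 𝓒) v
    quadratic = trans (⊗-congˡ C v (λ p → trans (mono⊗mono⊗ tv xv C p) (shift-C txv p))) (⊗-congʳ (shift txv 𝓒) v C≐𝓒)
    linear : ((𝟙 ⊖ xᶜ ⊖ yᶜ ⊕ xᶜ ⊗ yᶜ ⊖ tᶜ ⊗ xᶜ ⊗ yᶜ ⊖ sᶜ ⊗ xᶜ ⊗ yᶜ) ⊗ C) v ≡ linearPart v
    linear = trans (⊗-distribʳ-⊖ P4 (sᶜ ⊗ xᶜ ⊗ yᶜ) C v) (cong₂ _-_
           (trans (⊗-distribʳ-⊖ P3 (tᶜ ⊗ xᶜ ⊗ yᶜ) C v) (cong₂ _-_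
             (trans (⊗-distribʳ-⊕ P2 (xᶜ ⊗ yᶜ) C v) (cong₂ _+_
               (trans (⊗-distribʳ-⊖ P1 yᶜ C v) (cong₂ _-_
                 (trans (⊗-distribʳ-⊖ 𝟙 xᶜ C v) (cong₂ _-_
                    (trans (𝟙⊗ C v) (C≐𝓒 v))
                    (trans (mono⊗≡shift xv C v) (shift-C xv v))))
                 (trans (mono⊗≡shift yv C v) (shift-C yv v))))
               (trans (mono⊗mono⊗ xv yv C v) (shift-C xyv v))))
             (trans (mono⊗mono⊗mono⊗ tv xv yv C v) (shift-C txyv v))))
           (trans (mono⊗mono⊗mono⊗ sv xv yv C v) (shift-C sxyv v)))
      where
      P1 P2 P3 P4 : Series 4
      P1 = 𝟙 ⊖ xᶜ
      P2 = P1 ⊖ yᶜ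
      P3 = P2 ⊕ xᶜ ⊗ yᶜ
      P4 = P3 ⊖ tᶜ ⊗ xᶜ ⊗ yᶜ

module NoDH where

  open WordSums
  open BargraphWalks using (vadd; yv; xv; txv; sxyv; eqV; ⟦_⟧; isBargraph′; weight; isBargraph≡isBargraph′)
  open SeriesAlgebra
  open Counting
  open FunctionalEquation
  open import Data.Nat as ℕ using (ℕ; zero; suc; _≡ᵇ_; _≤_; z≤n; s≤s)
  import Data.Nat.Properties as NP
  open import Data.Integer as ℤ using (ℤ; +_; 0ℤ; _+_; _-_; -_)
  import Data.Integer.Properties as ZP
  open import Data.List using (List; []; _∷_; length)
  open import Data.Vec using (Vec; []; _∷_)
  open import Data.Maybe using (Maybe; just; nothing)
  open import Data.Product using (_×_; _,_)
  open import Data.Bool using (true; false; if_then_else_; _∧_)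
  open import Data.Bool.Properties using (∧-zeroʳ; ∧-identityʳ)
  open import Relation.Binary.PropositionalEquality
  open import Data.Integer.Solver using (module +-*-Solver)
  open +-*-Solver using (solve; _:+_; _:-_; :-_; _:=_)

  quadraticPart-t⁰ : ∀ b h u → (shift txv 𝓒 ⊗ 𝓒) (0 ∷ b ∷ h ∷ u ∷ []) ≡ 0ℤ
  quadraticPart-t⁰ b h u =
    trans (⊗≡sumSplits (shift txv 𝓒) 𝓒 (0 ∷ b ∷ h ∷ u ∷ []))
      (trans (sumSplits-cons 0 (b ∷ h ∷ u ∷ []) (λ p q → shift txv 𝓒 p ℤ.* 𝓒 q))
        (cong (_+ 0ℤ) (sumSplits-zero (b ∷ h ∷ u ∷ []) _ (λ p q → refl))))

  linear≡constant : ∀ (K PC one : ℤ) → K ≡ 0ℤ → (K - PC) + one ≡ 0ℤ → PC ≡ one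
  linear≡constant K PC one k h =
    trans (solve 3 (λ K PC one → PC := (one :- ((K :- PC) :+ one)) :+ K) refl K PC one)
     (trans (cong₂ (λ a b → (one - a) + b) h k) (trans (ZP.+-identityʳ _) (ZP.+-identityʳ one)))

  linearPart-t⁰ : ∀ b h u → linearPart (0 ∷ b ∷ h ∷ u ∷ []) ≡ mono sxyv (0 ∷ b ∷ h ∷ u ∷ [])
  linearPart-t⁰ b h u =
    linear≡constant _ _ _ (quadraticPart-t⁰ b h u) (functionalEquation-coeff (0 ∷ b ∷ h ∷ u ∷ []))

  sumBelowℕ : ℕ → (ℕ → ℕ) → ℕ
  sumBelowℕ zero g = 0
  sumBelowℕ (suc n) g = g 0 ℕ.+ sumBelowℕ n (λ x → g (suc x))

  sumBelow-pos : ∀ n (f : ℕ → ℕ) → sumBelow n (λ b → + f b) ≡ + sumBelowℕ n f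
  sumBelow-pos zero f = refl
  sumBelow-pos (suc n) f rewrite sumBelow-pos n (λ x → f (suc x)) = refl

  sumBelowℕ-cong : ∀ M {f g : ℕ → ℕ} → (∀ b → f b ≡ g b) → sumBelowℕ M f ≡ sumBelowℕ M g
  sumBelowℕ-cong zero e = refl
  sumBelowℕ-cong (suc M) e = cong₂ ℕ._+_ (e 0) (sumBelowℕ-cong M (λ b → e (suc b)))

  sumBelowℕ-sumWords : ∀ M n (g : ℕ → List Step → ℕ) →
    sumBelowℕ M (λ b → sumWords n (g b)) ≡ sumWords n (λ G → sumBelowℕ M (λ b → g b G))
  sumBelowℕ-sumWords zero n g = sym (sumWords-zero n _ (λ _ _ → refl))
  sumBelowℕ-sumWords (suc M) n g =
    trans (cong (ℕ._+_ (sumWords n (g 0))) (sumBelowℕ-sumWords M n (λ b → g (suc b)))) (sym (sumWords-+ n _ _))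

  sumBelowℕ-zero : ∀ M (g : ℕ → ℕ) → (∀ b → g b ≡ 0) → sumBelowℕ M g ≡ 0
  sumBelowℕ-zero zero g e = refl
  sumBelowℕ-zero (suc M) g e rewrite e 0 = sumBelowℕ-zero M _ (λ b → e (suc b))

  sumBelowℕ-indicator : ∀ X x M → x ≤ M → sumBelowℕ (suc M) (λ b → ⟦ X ∧ (x ≡ᵇ b) ⟧) ≡ ⟦ X ⟧
  sumBelowℕ-indicator false x M x≤M = sumBelowℕ-zero (suc M) _ (λ _ → refl)
  sumBelowℕ-indicator true zero M x≤M = cong suc (sumBelowℕ-zero M _ (λ _ → refl))
  sumBelowℕ-indicator true (suc x) (suc M) (s≤s x≤M) = sumBelowℕ-indicator true x M x≤M

  #factor≤length : ∀ a b G → #factor a b G ≤ length G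
  #factor≤length a b [] = z≤n
  #factor≤length a b (s ∷ []) = z≤n
  #factor≤length a b (s ∷ s' ∷ w) = bit+≤suc ((s =ˢ a) ∧ (s' =ˢ b)) (#factor≤length a b (s' ∷ w))
    where
    bit+≤suc : ∀ c {n m} → n ≤ m → (if c then 1 else 0) ℕ.+ n ≤ suc m
    bit+≤suc true n≤m = s≤s n≤m
    bit+≤suc false n≤m = NP.m≤n⇒m≤1+n n≤m

  ∧-moveLast : ∀ g d x h u → ⟦ g ∧ (d ∧ (x ∧ (h ∧ (u ∧ true)))) ⟧ ≡ ⟦ (g ∧ d ∧ h ∧ u) ∧ x ⟧
  ∧-moveLast false d x h u = refl
  ∧-moveLast true false x h u = refl
  ∧-moveLast true true x false u rewrite ∧-zeroʳ x = refl
  ∧-moveLast true true x true false rewrite ∧-zeroʳ x = refl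
  ∧-moveLast true true x true true rewrite ∧-identityʳ x = refl

  B≡sum𝓒 : ∀ h u M → h ℕ.+ 2 ℕ.* u ≤ M → B (h ∷ u ∷ []) ≡ sumBelow (suc M) (λ b → 𝓒 (0 ∷ b ∷ h ∷ u ∷ []))
  B≡sum𝓒 h u M n≤M = sym (begin
      sumBelow (suc M) (λ b → 𝓒 (0 ∷ b ∷ h ∷ u ∷ []))
    ≡⟨ sumBelow-pos (suc M) (λ b → #words isBargraph′ (0 ∷ b ∷ h ∷ u ∷ [])) ⟩
      + sumBelowℕ (suc M) (λ b → #words isBargraph′ (0 ∷ b ∷ h ∷ u ∷ []))
    ≡⟨ cong +_ (sumBelowℕ-sumWords (suc M) n (λ b G → ⟦ isBargraph′ G ∧ eqV (weight G) (0 ∷ b ∷ h ∷ u ∷ []) ⟧)) ⟩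
      + sumWords n (λ G → sumBelowℕ (suc M) (λ b → ⟦ isBargraph′ G ∧ eqV (weight G) (0 ∷ b ∷ h ∷ u ∷ []) ⟧))
    ≡⟨ cong +_ (sumWords-cong n (λ G lG → forgetUH G lG)) ⟩
      + sumWords n (λ G → ⟦ isBargraph′ G ∧ (#DH G ≡ᵇ 0) ∧ (#H G ≡ᵇ h) ∧ (#U G ≡ᵇ u) ⟧)
    ≡⟨ cong +_ (sym (trans (#sat≡sumMap (noDH h u) (words n)) (sumWords-cong n (λ G _ →
         cong ⟦_⟧ (cong (_∧ ((#DH G ≡ᵇ 0) ∧ (#H G ≡ᵇ h) ∧ (#U G ≡ᵇ u))) (isBargraph≡isBargraph′ G)))))) ⟩
      B (h ∷ u ∷ [])
    ∎)
    where
    open ≡-Reasoning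
    n = h ℕ.+ 2 ℕ.* u
    forgetUH : ∀ G → length G ≡ n → sumBelowℕ (suc M) (λ b → ⟦ isBargraph′ G ∧ eqV (weight G) (0 ∷ b ∷ h ∷ u ∷ []) ⟧)
                                  ≡ ⟦ isBargraph′ G ∧ (#DH G ≡ᵇ 0) ∧ (#H G ≡ᵇ h) ∧ (#U G ≡ᵇ u) ⟧
    forgetUH G lG =
      trans (sumBelowℕ-cong (suc M) (λ b → ∧-moveLast (isBargraph′ G) (#DH G ≡ᵇ 0) (#UH G ≡ᵇ b) (#H G ≡ᵇ h) (#U G ≡ᵇ u)))
            (sumBelowℕ-indicator _ (#UH G) M (NP.≤-trans (#factor≤length U H G) (NP.≤-trans (NP.≤-reflexive lG) n≤M)))

  wordLength₂ : Vec ℕ 2 → ℕ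
  wordLength₂ (h ∷ u ∷ []) = h ℕ.+ 2 ℕ.* u

  sumBelow-maybe0-𝓒 : ∀ (r : Maybe (Vec ℕ 2)) M → (∀ p → r ≡ just p → wordLength₂ p ≤ M) →
    sumBelow (suc M) (λ b → maybe0 (consIf true 0 (consIf true b r)) 𝓒) ≡ maybe0 r B
  sumBelow-maybe0-𝓒 nothing M bd = sumBelow-zero (suc M) _ (λ _ → refl)
  sumBelow-maybe0-𝓒 (just (h ∷ u ∷ [])) M bd = sym (B≡sum𝓒 h u M (bd _ refl))

  wordLength₂-vadd : ∀ p e → wordLength₂ (vadd p e) ≡ wordLength₂ p ℕ.+ wordLength₂ e
  wordLength₂-vadd (h ∷ u ∷ []) (h' ∷ u' ∷ []) = wordLength-vadd (0 ∷ 0 ∷ h ∷ u ∷ []) (0 ∷ 0 ∷ h' ∷ u' ∷ [])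

  sumBelow-shift-𝓒 : ∀ eh eu h u M → h ℕ.+ 2 ℕ.* u ≤ M →
    sumBelow (suc M) (λ b → shift (0 ∷ 0 ∷ eh ∷ eu ∷ []) 𝓒 (0 ∷ b ∷ h ∷ u ∷ [])) ≡ shift (eh ∷ eu ∷ []) B (h ∷ u ∷ [])
  sumBelow-shift-𝓒 eh eu h u M n≤M = sumBelow-maybe0-𝓒 (sub? (h ∷ u ∷ []) (eh ∷ eu ∷ [])) M (λ p e →
    NP.≤-trans (NP.m≤m+n (wordLength₂ p) (wordLength₂ (eh ∷ eu ∷ [])))
      (NP.≤-trans (NP.≤-reflexive (trans (sym (wordLength₂-vadd p (eh ∷ eu ∷ [])))
                                         (cong wordLength₂ (sym (sub?⇒vadd (h ∷ u ∷ []) (eh ∷ eu ∷ []) p e)))))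
                  n≤M))

  sumBelow-shift-sxy-𝓒 : ∀ h u K → h ℕ.+ 2 ℕ.* u ≤ suc K →
    sumBelow (suc (suc K)) (λ b → shift sxyv 𝓒 (0 ∷ b ∷ h ∷ u ∷ [])) ≡ shift (1 ∷ 1 ∷ []) B (h ∷ u ∷ [])
  sumBelow-shift-sxy-𝓒 h u K n≤1+K = trans (ZP.+-identityˡ _) (sumBelow-maybe0-𝓒 (sub? (h ∷ u ∷ []) (1 ∷ 1 ∷ [])) K bound)
    where
    bound : ∀ p → sub? (h ∷ u ∷ []) (1 ∷ 1 ∷ []) ≡ just p → wordLength₂ p ≤ K
    bound p e = NP.≤-trans (NP.n≤1+n (wordLength₂ p)) (NP.≤-trans (NP.n≤1+n (suc (wordLength₂ p))) (NP.≤-pred 3+p≤1+K))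
      where
      3+p≡n : suc (suc (suc (wordLength₂ p))) ≡ h ℕ.+ 2 ℕ.* u
      3+p≡n = trans (NP.+-comm 3 (wordLength₂ p))
        (trans (sym (wordLength₂-vadd p (1 ∷ 1 ∷ []))) (cong wordLength₂ (sym (sub?⇒vadd (h ∷ u ∷ []) (1 ∷ 1 ∷ []) p e))))
      3+p≤1+K : suc (suc (suc (wordLength₂ p))) ≤ suc K
      3+p≤1+K = NP.≤-trans (NP.≤-reflexive 3+p≡n) n≤1+K

  indℤ-∧ : ∀ a b → indℤ (a ∧ b) ≡ (if a then indℤ b else 0ℤ)
  indℤ-∧ true b = refl
  indℤ-∧ false b = refl

  sumBelow-mono-sxy : ∀ h u K →
    sumBelow (suc (suc K)) (λ b → mono sxyv (0 ∷ b ∷ h ∷ u ∷ [])) ≡ mono (1 ∷ 1 ∷ []) (h ∷ u ∷ [])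
  sumBelow-mono-sxy h u K =
    trans (sumBelow-cong (suc (suc K)) (λ b _ → trans (mono≡indℤ sxyv (0 ∷ b ∷ h ∷ u ∷ [])) (indℤ-∧ (b ≡ᵇ 1) _)))
      (trans (sumBelow-indicator 1 (suc K) (λ _ → indℤ (eqV (h ∷ u ∷ []) (1 ∷ 1 ∷ []))))
             (sym (mono≡indℤ (1 ∷ 1 ∷ []) (h ∷ u ∷ []))))

  x2 y2 : Vec ℕ 2
  x2 = 1 ∷ 0 ∷ []
  y2 = 0 ∷ 1 ∷ []

  noDHEquation : ((𝟙 ⊖ x² ⊖ y²) ⊗ B) ≐ (x² ⊗ y²)
  noDHEquation (h ∷ u ∷ []) =
    trans (⊗-distribʳ-⊖ (𝟙 ⊖ x²) y² B w)
      (trans (cong₂ _-_ (trans (⊗-distribʳ-⊖ 𝟙 x² B w) (cong₂ _-_ (𝟙⊗ B w) (mono⊗≡shift x2 B w))) (mono⊗≡shift y2 B w))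
        (trans core (sym (trans (mono⊗≡shift x2 y² w) (sym (mono-vadd≡shift x2 y2 w))))))
    where
    w = h ∷ u ∷ []
    K = h ℕ.+ 2 ℕ.* u
    N = suc (suc K)
    vb : ℕ → Vec ℕ 4
    vb b = 0 ∷ b ∷ h ∷ u ∷ []
    sumPC : sumBelow N (λ b → linearPart (vb b)) ≡ mono (1 ∷ 1 ∷ []) w
    sumPC = trans (sumBelow-cong N (λ b _ → linearPart-t⁰ b h u)) (sumBelow-mono-sxy h u K)
    expand : sumBelow N (λ b → linearPart (vb b)) ≡
      ((((B w - shift x2 B w) - shift y2 B w) + shift (1 ∷ 1 ∷ []) B w) - 0ℤ) - shift (1 ∷ 1 ∷ []) B w
    expand =
      trans (sumBelow-− N (λ b → (((f1 b - f2 b) - f3 b) + f4 b) - f5 b) f6) (cong₂ _-_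
       (trans (sumBelow-− N (λ b → ((f1 b - f2 b) - f3 b) + f4 b) f5) (cong₂ _-_
         (trans (sumBelow-+ N (λ b → (f1 b - f2 b) - f3 b) f4) (cong₂ _+_
           (trans (sumBelow-− N (λ b → f1 b - f2 b) f3) (cong₂ _-_
             (trans (sumBelow-− N f1 f2) (cong₂ _-_
                (sym (B≡sum𝓒 h u (suc K) (NP.n≤1+n K)))
                (sumBelow-shift-𝓒 1 0 h u (suc K) (NP.n≤1+n K))))
             (sumBelow-shift-𝓒 0 1 h u (suc K) (NP.n≤1+n K))))
           (sumBelow-shift-𝓒 1 1 h u (suc K) (NP.n≤1+n K))))
         (sumBelow-zero N f5 (λ _ → refl))))
       (sumBelow-shift-sxy-𝓒 h u K (NP.n≤1+n K)))
      where
      f1 f2 f3 f4 f5 f6 : ℕ → ℤ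
      f1 b = 𝓒 (vb b)
      f2 b = shift xv 𝓒 (vb b)
      f3 b = shift yv 𝓒 (vb b)
      f4 b = shift xyv 𝓒 (vb b)
      f5 b = shift txyv 𝓒 (vb b)
      f6 b = shift sxyv 𝓒 (vb b)
    core : (B w - shift x2 B w) - shift y2 B w ≡ mono (1 ∷ 1 ∷ []) w
    core = trans (solve 4 (λ a b c d → (a :- b) :- c := ((((a :- b) :- c) :+ d) :+ (:- (con 0ℤ))) :- d) refl
                    (B w) (shift x2 B w) (shift y2 B w) (shift (1 ∷ 1 ∷ []) B w))
                 (trans (sym expand) sumPC)
      where open +-*-Solver using (con)

mainTheorem6 : (tᶜ ⊗ xᶜ ⊗ C ⊗ C
    ⊖ (𝟙 ⊖ xᶜ ⊖ yᶜ ⊕ xᶜ ⊗ yᶜ ⊖ tᶜ ⊗ xᶜ ⊗ yᶜ ⊖ sᶜ ⊗ xᶜ ⊗ yᶜ) ⊗ C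
    ⊕ sᶜ ⊗ xᶜ ⊗ yᶜ) ≐ 𝟘
    × ((𝟙 ⊖ x² ⊖ y²) ⊗ B) ≐ (x² ⊗ y²)
mainTheorem6 = FunctionalEquation.functionalEquation , NoDH.noDHEquation
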